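{- Let $M$ be a Turing transducer computing a partial function $f_M:\Sigma^*\rightharpoonup\Sigma^*$ over a finite alphabet $\Sigma$. Then there is an $\mathbf{ST}$-program $P_M$ such that for every $w\in\Sigma^*$ (on which $f_M$ is defined), $P_M$ transforms $\mathcal{T}(w)$ into $\mathcal{T}(f_M(w))$, i.e. $\mathcal{T}(w) \Rightarrow_{P_M} \tau$ for some expansion $\tau$ of (a copy, up to renaming of atoms, of) $\mathcal{T}(f_M(w))$.
   Context: Atoms: a denumerable set $A$, plus an "undefined" object $\bot$. A vocabulary is a finite set of function identifiers with arities (nullary ones are tokens, unary ones pointers). An $A$-structure $\sigma$ over a vocabulary $V$ assigns to each $k$-ary identifier a finite partial function $A^k\rightharpoonup A$, extended strictly to $\bot$ (value $\bot$ when undefined or when an argument is $\bot$); tokens get values in $A\cup\{\bot\}$. The scope of $\sigma$ is the set of atoms occurring in entries of its components. Terms over $V$: $\omega$ (denoting $\bot$) and $\mathbf f t_1\cdots t_k$; a term is standard if $\omega$ does not occur in it. $\tau$ is an expansion of $\sigma$ if $\tau$ is over a larger vocabulary and agrees with $\sigma$ on $\sigma$'s identifiers. For a string $w=\gamma_1\cdots\gamma_k$ over an alphabet $\Sigma$, $\mathcal{T}(w)$ is the structure over the vocabulary consisting of a token $\mathtt e$ and a pointer for each symbol of $\Sigma$, with $k+1$ distinct atoms $c_0,\dots,c_k$, $\mathtt e=c_0$, $\gamma_i(c_{i-1})=c_i$, and all pointers otherwise undefined. $\mathbf{ST}$-programs act on $A$-structures. Basic revisions (each produces $\sigma'$ equal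 to $\sigma$ except as stated; identifiers not yet present are treated as interpreted by the empty function, and the vocabulary is extended): extension $\mathbf f t_1\cdots t_k := q$ ($t_i$ standard terms, $q$ a term): if $\sigma(\mathbf f t_1\cdots t_k)=\bot$ then $\sigma'(\mathbf f t_1\cdots t_k)=\sigma(q)$; inception $\mathbf c\Downarrow$ ($\mathbf c$ a token): if $\sigma(\mathbf c)=\bot$ then $\sigma'(\mathbf c)$ is an atom not in the scope of $\sigma$; contraction $\mathbf f \alpha_1\cdots\alpha_k\uparrow$: $\sigma'(\mathbf f\alpha_1\cdots\alpha_k)=\bot$; deletion $\mathbf c\Uparrow$: for every component $f$ and arguments $\vec a$ with $\sigma(f)\vec a=\sigma(\mathbf c)$, set $\sigma'(f)\vec a=\bot$. A guard is a quantifier-free formula (built from equations between terms with propositional connectives). Programs: every revision is a program; if $P,Q$ are programs and $G$ a guard then $P;Q$, $\mathbf{if}[G]\{P\}\{Q\}$ and $\mathbf{do}[G]\{P\}$ are programs, with the usual semantics (sequencing, branching on the truth of $G$ in the current structure, and iterating $P$ while $G$ holds). The yield relation $\sigma\Rightarrow_P\tau$ holds when the execution of $P$ starting from $\sigma$ terminates in $\tau$. -}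

module Defs where

open import Data.Nat using (ℕ; zero; suc; _<?_)
import Data.Nat as N
open import Data.Fin using (Fin; toℕ; fromℕ<)
import Data.Fin as F
open import Data.Bool using (Bool; true; false; if_then_else_; _∧_; _∨_; not)
open import Data.Maybe using (Maybe; just; nothing)
import Data.Maybe.Properties as MP
open import Data.Product using (Σ; _×_; _,_; proj₁; proj₂)
import Data.Product.Properties as PP
open import Data.Sum using (_⊎_; inj₁; inj₂)
open import Data.List using (List; []; _∷_; map; allFin)
open import Data.List.Membership.Propositional using (_∈_)
open import Data.Vec using (Vec; []; _∷_)
import Data.Vec.Properties as VP
import Data.Vec.Membership.Propositional as VM
open import Data.Empty using (⊥)
open import Data.Unit using (⊤)
open import Relation.Nullary using (¬_; yes; no; does)
open import Relation.Binary.PropositionalEquality using (_≡_; refl)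
open import Relation.Binary.Definitions using (DecidableEquality)

-- The denumerable set of atoms A; the undefined object ⊥ is `nothing`.
Atom : Set
Atom = ℕ

-- A function identifier: (name , arity).  Tokens have arity 0, pointers arity 1.
Ident : Set
Ident = ℕ × ℕ

arity : Ident → ℕ
arity = proj₂

_≟I_ : DecidableEquality Ident
_≟I_ = PP.≡-dec N._≟_ N._≟_

_≟A_ : DecidableEquality (Maybe Atom)
_≟A_ = MP.≡-dec N._≟_

-- An A-structure: a (finite) vocabulary and, for every identifier, a partial
-- function A^k ⇀ A (identifiers outside the vocabulary are interpreted by the
-- empty function).  Strictness w.r.t. ⊥ is built into term evaluation below.
record Structure : Set where
  field
    voc : List Ident
    val : (f : Ident) → Vec Atom (arity f) → Maybe Atom
open Structure public

InScope : Structure → Atom → Set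
InScope σ a = Σ Ident λ f → Σ (Vec Atom (arity f)) λ as → Σ Atom λ b →
              (val σ f as ≡ just b) × ((a ≡ b) ⊎ (a VM.∈ as))

Expansion : Structure → Structure → Set
Expansion τ σ = (∀ f → f ∈ voc σ → f ∈ voc τ) ×
                (∀ f → f ∈ voc σ → ∀ as → val τ f as ≡ val σ f as)

data Term : Set where
  ω   : Term
  app : (f : Ident) → Vec Term (arity f) → Term

mutual
  eval : Structure → Term → Maybe Atom
  eval σ ω = nothing
  eval σ (app f ts) with evalArgs σ ts
  ... | nothing = nothing
  ... | just as = val σ f as

  evalArgs : Structure → ∀ {k} → Vec Term k → Maybe (Vec Atom k)
  evalArgs σ [] = just []
  evalArgs σ (t ∷ ts) with eval σ t | evalArgs σ ts
  ... | just a | just as = just (a ∷ as)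
  ... | _ | _ = nothing

mutual
  Standard : Term → Set
  Standard ω = ⊥
  Standard (app f ts) = AllStandard ts

  AllStandard : ∀ {k} → Vec Term k → Set
  AllStandard [] = ⊤
  AllStandard (t ∷ ts) = Standard t × AllStandard ts

data Guard : Set where
  _≐_  : Term → Term → Guard
  gnot : Guard → Guard
  gand : Guard → Guard → Guard
  gor  : Guard → Guard → Guard

holds : Structure → Guard → Bool
holds σ (t ≐ q) = does (eval σ t ≟A eval σ q)
holds σ (gnot G) = not (holds σ G)
holds σ (gand G H) = holds σ G ∧ holds σ H
holds σ (gor G H) = holds σ G ∨ holds σ H

data Revision : Set where
  extension   : (f : Ident) (ts : Vec Term (arity f)) → AllStandard ts → (q : Term) → Revision
  inception   : (c : ℕ) → Revision
  contraction : (f : Ident) → Vec Term (arity f) → Revision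
  deletion    : (c : ℕ) → Revision

Interp : Set
Interp = (f : Ident) → Vec Atom (arity f) → Maybe Atom

upd : Interp → (f : Ident) → Vec Atom (arity f) → Maybe Atom → Interp
upd v f as r g bs with g ≟I f
... | no _ = v g bs
... | yes refl with VP.≡-dec N._≟_ bs as
...   | yes _ = r
...   | no _ = v g bs

addVoc : Ident → Structure → Structure
addVoc f σ = record { voc = f ∷ voc σ ; val = val σ }

setAt : Structure → (f : Ident) → Vec Atom (arity f) → Maybe Atom → Structure
setAt σ f as r = record { voc = f ∷ voc σ ; val = upd (val σ) f as r }

doExtension : Structure → (f : Ident) → Vec Term (arity f) → Term → Structure
doExtension σ f ts q with evalArgs σ ts
... | nothing = addVoc f σ
... | just as with val σ f as
...   | just _ = addVoc f σ
...   | nothing = setAt σ f as (eval σ q)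

doContraction : Structure → (f : Ident) → Vec Term (arity f) → Structure
doContraction σ f ts with evalArgs σ ts
... | nothing = addVoc f σ
... | just as = setAt σ f as nothing

doDeletion : Structure → ℕ → Structure
doDeletion σ c = record
  { voc = (c , 0) ∷ voc σ
  ; val = λ g bs → if does (val σ g bs ≟A val σ (c , 0) []) then nothing else val σ g bs }

data Step : Revision → Structure → Structure → Set where
  ext    : ∀ {σ f ts} (st : AllStandard ts) {q} →
           Step (extension f ts st q) σ (doExtension σ f ts q)
  incDef : ∀ {σ c a} → val σ (c , 0) [] ≡ just a →
           Step (inception c) σ (addVoc (c , 0) σ)
  incNew : ∀ {σ c} → val σ (c , 0) [] ≡ nothing → (a : Atom) → ¬ InScope σ a →
           Step (inception c) σ (setAt σ (c , 0) [] (just a))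
  contr  : ∀ {σ f ts} → Step (contraction f ts) σ (doContraction σ f ts)
  del    : ∀ {σ c} → Step (deletion c) σ (doDeletion σ c)

data Program : Set where
  rev   : Revision → Program
  _⨾_   : Program → Program → Program
  ifP   : Guard → Program → Program → Program
  doP   : Guard → Program → Program

data Yield : Program → Structure → Structure → Set where
  yRev  : ∀ {r σ τ} → Step r σ τ → Yield (rev r) σ τ
  ySeq  : ∀ {P Q σ ρ τ} → Yield P σ ρ → Yield Q ρ τ → Yield (P ⨾ Q) σ τ
  yIfT  : ∀ {G P Q σ τ} → holds σ G ≡ true  → Yield P σ τ → Yield (ifP G P Q) σ τ
  yIfF  : ∀ {G P Q σ τ} → holds σ G ≡ false → Yield Q σ τ → Yield (ifP G P Q) σ τ
  yDoF  : ∀ {G P σ} → holds σ G ≡ false → Yield (doP G P) σ σ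
  yDoT  : ∀ {G P σ ρ τ} → holds σ G ≡ true → Yield P σ ρ → Yield (doP G P) ρ τ →
          Yield (doP G P) σ τ

-- The structure 𝒯(w) over Σ = Fin s, with atoms c 0 , … , c k
-- (token 𝚎 = identifier (0 , 0); symbol γ = pointer (suc (toℕ γ) , 1)).

strVoc : ℕ → List Ident
strVoc s = (0 , 0) ∷ map (λ (γ : Fin s) → (suc (toℕ γ) , 1)) (allFin s)

ptr : ∀ {s} → (ℕ → Atom) → ℕ → List (Fin s) → Fin s → Atom → Maybe Atom
ptr c i [] γ a = nothing
ptr c i (x ∷ xs) γ a =
  if does (c i N.≟ a) ∧ does (x F.≟ γ) then just (c (suc i)) else ptr c (suc i) xs γ a

strVal : ∀ {s} → (ℕ → Atom) → List (Fin s) → Interp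
strVal c w (zero , zero) [] = just (c 0)
strVal {s} c w (suc j , suc zero) (a ∷ []) with j <? s
... | yes j<s = ptr c 0 w (fromℕ< j<s) a
... | no _ = nothing
strVal c w _ _ = nothing

𝒯 : ∀ {s} → (ℕ → Atom) → List (Fin s) → Structure
𝒯 {s} c w = record { voc = strVoc s ; val = strVal c w }

-- Turing transducers (deterministic, single two-way infinite tape)

data Move : Set where
  L R : Move

-- tape symbols: nothing = blank, inj₁ = input/output symbol, inj₂ = auxiliary
TapeSym : ℕ → ℕ → Set
TapeSym s k = Maybe (Fin s ⊎ Fin k)

record TM (s : ℕ) : Set where
  field
    nQ    : ℕ
    nX    : ℕ
    start : Fin nQ
    δ     : Fin nQ → TapeSym s nX → Maybe (Fin nQ × TapeSym s nX × Move)
    -- δ q x ≡ nothing means M halts in state q reading x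

module _ {s : ℕ} (M : TM s) where
  open TM M

  -- state, tape left of head (nearest first), symbol under head, tape right of head
  record Config : Set where
    constructor cfg
    field
      state : Fin nQ
      left  : List (TapeSym s nX)
      head  : TapeSym s nX
      right : List (TapeSym s nX)

  step : Config → Maybe Config
  step (cfg q l h r) with δ q h
  ... | nothing = nothing
  ... | just (q' , x , L) with l
  ...   | [] = just (cfg q' [] nothing (x ∷ r))
  ...   | y ∷ ys = just (cfg q' ys y (x ∷ r))
  step (cfg q l h r) | just (q' , x , R) with r
  ...   | [] = just (cfg q' (x ∷ l) nothing [])
  ...   | y ∷ ys = just (cfg q' (x ∷ l) y ys)

  initial : List (Fin s) → Config
  initial [] = cfg start [] nothing []
  initial (γ ∷ w) = cfg start [] (just (inj₁ γ)) (map (λ x → just (inj₁ x)) w)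

  readOut : List (TapeSym s nX) → List (Fin s)
  readOut (just (inj₁ γ) ∷ xs) = γ ∷ readOut xs
  readOut _ = []

  output : Config → List (Fin s)
  output (cfg q l h r) = readOut (h ∷ r)

  data Reaches : Config → Config → Set where
    here  : ∀ {c} → Reaches c c
    there : ∀ {c c' d} → step c ≡ just c' → Reaches c' d → Reaches c d

  Computes : List (Fin s) → List (Fin s) → Set
  Computes w v = Σ Config λ d → Reaches (initial w) d × (step d ≡ nothing) × (output d ≡ v)

module Submission where

-- The program reads 𝒯(w) into a tape of M held as two stacks of cells (fresh atoms linked by
-- a pointer and labelled by their tape symbol), erasing the input pointers as it goes. It then
-- runs M, one loop iteration per step, recording the state by which of one token per state is
-- defined, and finally lays the output word out on fresh atoms. All atoms in use stay below a
-- bound B: this makes every inception fresh, confines the effect of each revision to a known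
-- frame, and shows the result to be 𝒯(f_M(w)) up to the renaming j ↦ j + B of atoms.

open import Defs
open import Data.Bool using (true; false; _∧_; _∨_)
open import Data.Bool.Properties using (∧-zeroʳ; ∨-zeroʳ)
open import Data.Empty using (⊥; ⊥-elim)
open import Data.Fin using (Fin; toℕ; fromℕ<)
import Data.Fin as F
import Data.Fin.Properties as FP
open import Data.List using (List; []; _∷_; _++_; _ʳ++_; length; map; allFin)
import Data.List.Properties as LP
open import Data.List.Membership.Propositional using (_∈_)
open import Data.List.Membership.Propositional.Properties using (∈-allFin; ∈-map⁺; ∈-map⁻; ∈-++⁺ˡ; ∈-++⁺ʳ)
open import Data.List.Relation.Unary.Any using (here; there)
open import Data.Maybe using (Maybe; just; nothing)
import Data.Maybe.Properties as MP
open import Data.Nat using (ℕ; zero; suc; _+_; _⊔_; _≤_; _<_; _<?_; z≤n; s≤s)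
import Data.Nat as N
import Data.Nat.Properties as NP
open import Data.Product using (Σ; _×_; _,_; proj₁; proj₂)
open import Data.Sum using (_⊎_; inj₁; inj₂)
import Data.Sum.Properties as SP
open import Data.Unit using (⊤; tt)
open import Data.Vec using (Vec; []; _∷_)
import Data.Vec as V
import Data.Vec.Properties as VP
import Data.Vec.Membership.Propositional as VM
import Data.Vec.Relation.Unary.Any as VAny
open import Function using (_∘_)
open import Function.Definitions using (Injective)
open import Relation.Binary.Definitions using (DecidableEquality)
open import Relation.Binary.PropositionalEquality
open import Relation.Nullary using (¬_; Dec; yes; no; does)
open import Relation.Nullary.Decidable using (dec-true; dec-false)

-- Single-entry updates

record _≈_[_,_↦_] (σ' σ : Structure) (f : Ident) (as : Vec Atom (arity f)) (r : Maybe Atom) : Set where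
  constructor mk≈
  field at : ∀ g bs → val σ' g bs ≡ upd (val σ) f as r g bs
open _≈_[_,_↦_]

module _ {σ σ' : Structure} {f : Ident} {as : Vec Atom (arity f)} {r : Maybe Atom}
         (e : σ' ≈ σ [ f , as ↦ r ]) where

  ≈-hit : val σ' f as ≡ r
  ≈-hit = trans (at e f as) (hit (val σ))
    where
    hit : ∀ v → upd v f as r f as ≡ r
    hit v with f ≟I f
    ... | no f≢f = ⊥-elim (f≢f refl)
    ... | yes refl with VP.≡-dec N._≟_ as as
    ...   | yes _ = refl
    ...   | no as≢as = ⊥-elim (as≢as refl)

  ≈-missᶦ : ∀ g bs → g ≢ f → val σ' g bs ≡ val σ g bs
  ≈-missᶦ g bs g≢f = trans (at e g bs) (miss (val σ))
    where
    miss : ∀ v → upd v f as r g bs ≡ v g bs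
    miss v with g ≟I f
    ... | no _ = refl
    ... | yes g≡f = ⊥-elim (g≢f g≡f)

  ≈-missᵃ : ∀ bs → bs ≢ as → val σ' f bs ≡ val σ f bs
  ≈-missᵃ bs bs≢as = trans (at e f bs) (miss (val σ))
    where
    miss : ∀ v → upd v f as r f bs ≡ v f bs
    miss v with f ≟I f
    ... | no _ = refl
    ... | yes refl with VP.≡-dec N._≟_ bs as
    ...   | yes bs≡as = ⊥-elim (bs≢as bs≡as)
    ...   | no _ = refl

≈-overwrite : ∀ {σ σ₁ σ₂ f as r₁ r₂} → σ₁ ≈ σ [ f , as ↦ r₁ ] → σ₂ ≈ σ₁ [ f , as ↦ r₂ ] →
              σ₂ ≈ σ [ f , as ↦ r₂ ]
≈-overwrite {σ} {σ₁} {σ₂} {f} {as} {r₁} {r₂} e₁ e₂ = mk≈ λ g bs → trans (at e₂ g bs) (same g bs)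
  where
  same : ∀ g bs → upd (val σ₁) f as r₂ g bs ≡ upd (val σ) f as r₂ g bs
  same g bs with g ≟I f
  ... | no g≢f = ≈-missᶦ e₁ g bs g≢f
  ... | yes refl with VP.≡-dec N._≟_ bs as
  ...   | yes _ = refl
  ...   | no bs≢as = ≈-missᵃ e₁ bs bs≢as

-- Tokens and pointers

tok : Structure → ℕ → Maybe Atom
tok σ n = val σ (n , 0) []

deref : Structure → ℕ → Atom → Maybe Atom
deref σ p a = val σ (p , 1) (a ∷ [])

var : ℕ → Term
var n = app (n , 0) []

_＠_ : ℕ → ℕ → Term
p ＠ n = app (p , 1) (var n ∷ [])

eval-＠ : ∀ σ p n {a} → tok σ n ≡ just a → eval σ (p ＠ n) ≡ deref σ p a
eval-＠ σ p n e rewrite e = refl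

eval-＠-undefined : ∀ σ p n → tok σ n ≡ nothing → eval σ (p ＠ n) ≡ nothing
eval-＠-undefined σ p n e rewrite e = refl

module _ {σ σ' : Structure} where

  tok-hit : ∀ {m r} → σ' ≈ σ [ (m , 0) , [] ↦ r ] → tok σ' m ≡ r
  tok-hit = ≈-hit

  tok-miss : ∀ {m r} → σ' ≈ σ [ (m , 0) , [] ↦ r ] → ∀ n → n ≢ m → tok σ' n ≡ tok σ n
  tok-miss e n n≢m = ≈-missᶦ e (n , 0) [] λ eq → n≢m (cong proj₁ eq)

  tok-keeps-deref : ∀ {m r} → σ' ≈ σ [ (m , 0) , [] ↦ r ] → ∀ p a → deref σ' p a ≡ deref σ p a
  tok-keeps-deref e p a = ≈-missᶦ e (p , 1) (a ∷ []) λ ()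

  deref-hit : ∀ {q b r} → σ' ≈ σ [ (q , 1) , b ∷ [] ↦ r ] → deref σ' q b ≡ r
  deref-hit = ≈-hit

  deref-keeps-tok : ∀ {q bs r} → σ' ≈ σ [ (q , 1) , bs ↦ r ] → ∀ n → tok σ' n ≡ tok σ n
  deref-keeps-tok e n = ≈-missᶦ e (n , 0) [] λ ()

  deref-missᶦ : ∀ {q bs r} → σ' ≈ σ [ (q , 1) , bs ↦ r ] → ∀ p a → p ≢ q → deref σ' p a ≡ deref σ p a
  deref-missᶦ e p a p≢q = ≈-missᶦ e (p , 1) (a ∷ []) λ eq → p≢q (cong proj₁ eq)

  deref-missᵃ : ∀ {q b r} → σ' ≈ σ [ (q , 1) , b ∷ [] ↦ r ] → ∀ p a → a ≢ b → deref σ' p a ≡ deref σ p a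
  deref-missᵃ {q} e p a a≢b with (p , 1) ≟I (q , 1)
  ... | no p≢q = ≈-missᶦ e (p , 1) (a ∷ []) p≢q
  ... | yes refl = ≈-missᵃ e (a ∷ []) λ eq → a≢b (cong V.head eq)

  deref-miss : ∀ {q b r} → σ' ≈ σ [ (q , 1) , b ∷ [] ↦ r ] → ∀ p a → (p ≢ q) ⊎ (a ≢ b) →
               deref σ' p a ≡ deref σ p a
  deref-miss e p a (inj₁ p≢q) = deref-missᶦ e p a p≢q
  deref-miss e p a (inj₂ a≢b) = deref-missᵃ e p a a≢b

-- Atoms below a bound

record Bounded (σ : Structure) (B : ℕ) : Set where
  constructor mkBounded
  field bounded : ∀ f as b → val σ f as ≡ just b → (b < B) × (∀ a → a VM.∈ as → a < B)
open Bounded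

EntryBelow : ℕ → ∀ {k} → Vec Atom k → Maybe Atom → Set
EntryBelow B as r = ∀ b → r ≡ just b → (b < B) × (∀ a → a VM.∈ as → a < B)

Bounded⇒¬InScope : ∀ {σ B} → Bounded σ B → ¬ InScope σ B
Bounded⇒¬InScope bd (f , as , b , e , inj₁ refl) = NP.<-irrefl refl (proj₁ (bounded bd f as b e))
Bounded⇒¬InScope bd (f , as , b , e , inj₂ B∈as) = NP.<-irrefl refl (proj₂ (bounded bd f as b e) _ B∈as)

Bounded-mono : ∀ {σ B B'} → B ≤ B' → Bounded σ B → Bounded σ B'
Bounded-mono B≤B' bd = mkBounded λ f as b e →
  NP.<-≤-trans (proj₁ (bounded bd f as b e)) B≤B' ,
  λ a a∈as → NP.<-≤-trans (proj₂ (bounded bd f as b e) a a∈as) B≤B'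

Bounded-≈ : ∀ {σ σ' B f as r} → Bounded σ B → σ' ≈ σ [ f , as ↦ r ] → EntryBelow B as r → Bounded σ' B
Bounded-≈ {σ} {σ'} {B} {f} {as} {r} bd e below = mkBounded entry
  where
  entry : ∀ g bs b → val σ' g bs ≡ just b → (b < B) × (∀ a → a VM.∈ bs → a < B)
  entry g bs b eq with g ≟I f
  ... | no g≢f = bounded bd g bs b (trans (sym (≈-missᶦ e g bs g≢f)) eq)
  ... | yes refl with VP.≡-dec N._≟_ bs as
  ...   | yes refl = below b (trans (sym (≈-hit e)) eq)
  ...   | no bs≢as = bounded bd g bs b (trans (sym (≈-missᵃ e bs bs≢as)) eq)

tok-bounded : ∀ {σ B n a} → Bounded σ B → tok σ n ≡ just a → a < B
tok-bounded {n = n} {a} bd e = proj₁ (bounded bd (n , 0) [] a e)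

deref-bounded : ∀ {σ B p a b} → Bounded σ B → deref σ p a ≡ just b → b < B
deref-bounded {p = p} {a} {b} bd e = proj₁ (bounded bd (p , 1) (a ∷ []) b e)

deref-arg-bounded : ∀ {σ B p a b} → Bounded σ B → deref σ p a ≡ just b → a < B
deref-arg-bounded {p = p} {a} {b} bd e = proj₂ (bounded bd (p , 1) (a ∷ []) b e) a (VAny.here refl)

deref-bound : ∀ {σ B p} → Bounded σ B → deref σ p B ≡ nothing
deref-bound {σ} {B} {p} bd with deref σ p B in eq
... | nothing = refl
... | just _ = ⊥-elim (NP.<-irrefl refl (deref-arg-bounded bd eq))

eval-var-bounded : ∀ {σ B} n → Bounded σ B → EntryBelow B [] (eval σ (var n))
eval-var-bounded n bd b e = tok-bounded {n = n} bd e , λ _ ()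

eval-＠-bounded : ∀ {σ B} p n → Bounded σ B → EntryBelow B [] (eval σ (p ＠ n))
eval-＠-bounded {σ} p n bd b e = below (tok σ n) refl , λ _ ()
  where
  below : ∀ m → tok σ n ≡ m → b < _
  below (just a) tn = deref-bounded bd (trans (sym (eval-＠ σ p n tn)) e)
  below nothing tn with () ← trans (sym (eval-＠-undefined σ p n tn)) e

-- Elementary revisions

contract : ℕ → Program
contract n = rev (contraction (n , 0) [])

incept : ℕ → Program
incept n = rev (inception n)

extend : ℕ → Term → Program
extend n q = rev (extension (n , 0) [] tt q)

extendAt : ℕ → ℕ → Term → Program
extendAt p n q = rev (extension (p , 1) (var n ∷ []) (tt , tt) q)

contractAt : ℕ → ℕ → Program
contractAt p n = rev (contraction (p , 1) (var n ∷ []))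

assign : ℕ → Term → Program
assign n q = contract n ⨾ extend n q

fresh : ℕ → Program
fresh n = contract n ⨾ incept n

Revises : Program → Structure → ℕ → (f : Ident) → Vec Atom (arity f) → Maybe Atom → Set
Revises P σ B f as r = Σ Structure λ σ' → Yield P σ σ' × σ' ≈ σ [ f , as ↦ r ] × Bounded σ' B

contract-revises : ∀ {σ B} → Bounded σ B → ∀ n → Revises (contract n) σ B (n , 0) [] nothing
contract-revises bd n = _ , yRev contr , mk≈ (λ _ _ → refl) , Bounded-≈ bd (mk≈ λ _ _ → refl) λ _ ()

contractAt-revises : ∀ {σ B} → Bounded σ B → ∀ p n {a} → tok σ n ≡ just a →
                     Revises (contractAt p n) σ B (p , 1) (a ∷ []) nothing
contractAt-revises {σ} bd p n {a} tn = _ , yRev contr , e , Bounded-≈ bd e λ _ ()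
  where
  e : doContraction σ (p , 1) (var n ∷ []) ≈ σ [ (p , 1) , a ∷ [] ↦ nothing ]
  e = mk≈ entry
    where
    entry : ∀ g bs → val (doContraction σ (p , 1) (var n ∷ [])) g bs ≡ upd (val σ) (p , 1) (a ∷ []) nothing g bs
    entry g bs rewrite tn = refl

extend-revises : ∀ {σ B} → Bounded σ B → ∀ n m → tok σ n ≡ nothing →
                 Revises (extend n (var m)) σ B (n , 0) [] (tok σ m)
extend-revises {σ} bd n m tn = _ , yRev (ext tt) , e , Bounded-≈ bd e (eval-var-bounded m bd)
  where
  e : doExtension σ (n , 0) [] (var m) ≈ σ [ (n , 0) , [] ↦ tok σ m ]
  e = mk≈ entry
    where
    entry : ∀ g bs → val (doExtension σ (n , 0) [] (var m)) g bs ≡ upd (val σ) (n , 0) [] (tok σ m) g bs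
    entry g bs rewrite tn = refl

extendAt-revises : ∀ {σ B} → Bounded σ B → ∀ p n m {a} → tok σ n ≡ just a → deref σ p a ≡ nothing →
                   Revises (extendAt p n (var m)) σ B (p , 1) (a ∷ []) (tok σ m)
extendAt-revises {σ} bd p n m {a} tn pa = _ , yRev (ext (tt , tt)) , e ,
  Bounded-≈ bd e λ b eq → tok-bounded {n = m} bd eq ,
                         λ { _ (VAny.here refl) → tok-bounded {n = n} bd tn ; _ (VAny.there ()) }
  where
  e : doExtension σ (p , 1) (var n ∷ []) (var m) ≈ σ [ (p , 1) , a ∷ [] ↦ tok σ m ]
  e = mk≈ entry
    where
    entry : ∀ g bs → val (doExtension σ (p , 1) (var n ∷ []) (var m)) g bs ≡
                     upd (val σ) (p , 1) (a ∷ []) (tok σ m) g bs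
    entry g bs rewrite tn | pa = refl

assign-revises : ∀ {σ B} → Bounded σ B → ∀ n m → m ≢ n → Revises (assign n (var m)) σ B (n , 0) [] (tok σ m)
assign-revises {σ} bd n m m≢n =
  let (σ₁ , y₁ , e₁ , bd₁) = contract-revises bd n
      (σ₂ , y₂ , e₂ , bd₂) = extend-revises bd₁ n m (tok-hit e₁)
  in σ₂ , ySeq y₁ y₂ , subst (σ₂ ≈ σ [ (n , 0) , [] ↦_]) (tok-miss e₁ m m≢n) (≈-overwrite e₁ e₂) , bd₂

assign-＠-revises : ∀ {σ B} → Bounded σ B → ∀ n p m {a} → m ≢ n → tok σ m ≡ just a →
                   Revises (assign n (p ＠ m)) σ B (n , 0) [] (deref σ p a)
assign-＠-revises {σ} bd n p m {a} m≢n tm =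
  let (σ₁ , y₁ , e₁ , bd₁) = contract-revises bd n
      e₂ : doExtension σ₁ (n , 0) [] (p ＠ m) ≈ σ₁ [ (n , 0) , [] ↦ eval σ₁ (p ＠ m) ]
      e₂ = mk≈ (entry σ₁ (tok-hit e₁))
      value : eval σ₁ (p ＠ m) ≡ deref σ p a
      value = trans (eval-＠ σ₁ p m (trans (tok-miss e₁ m m≢n) tm)) (tok-keeps-deref e₁ p a)
  in _ , ySeq y₁ (yRev (ext tt)) ,
     subst (doExtension σ₁ (n , 0) [] (p ＠ m) ≈ σ [ (n , 0) , [] ↦_]) value (≈-overwrite e₁ e₂) ,
     Bounded-≈ bd₁ e₂ (eval-＠-bounded p m bd₁)
  where
  entry : ∀ σ₁ → tok σ₁ n ≡ nothing → ∀ g bs →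
          val (doExtension σ₁ (n , 0) [] (p ＠ m)) g bs ≡ upd (val σ₁) (n , 0) [] (eval σ₁ (p ＠ m)) g bs
  entry σ₁ tn g bs rewrite tn = refl

fresh-revises : ∀ {σ B} → Bounded σ B → ∀ n → Revises (fresh n) σ (suc B) (n , 0) [] (just B)
fresh-revises {σ} {B} bd n =
  let (σ₁ , y₁ , e₁ , bd₁) = contract-revises bd n
      e₂ = mk≈ λ _ _ → refl
  in _ , ySeq y₁ (yRev (incNew (tok-hit e₁) B (Bounded⇒¬InScope bd₁))) , ≈-overwrite e₁ e₂ ,
     Bounded-≈ (Bounded-mono (NP.n≤1+n B) bd₁) e₂ λ { _ refl → NP.n<1+n B , λ _ () }

-- Guards and loops

isDefined : Term → Guard
isDefined t = gnot (t ≐ ω)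

never : Guard
never = gnot (ω ≐ ω)

skip : Program
skip = doP never (contract 0)

skip-yields : ∀ {σ} → Yield skip σ σ
skip-yields = yDoF refl

isDefined-just : ∀ σ t {a} → eval σ t ≡ just a → holds σ (isDefined t) ≡ true
isDefined-just σ t e rewrite e = refl

isDefined-nothing : ∀ σ t → eval σ t ≡ nothing → holds σ (isDefined t) ≡ false
isDefined-nothing σ t e rewrite e = refl

module _ {I : Set} where

  anyOf : List I → (I → Guard) → Guard
  anyOf [] g = never
  anyOf (x ∷ xs) g = gor (g x) (anyOf xs g)

  anyOf-true : ∀ σ (g : I → Guard) {x} xs → x ∈ xs → holds σ (g x) ≡ true → holds σ (anyOf xs g) ≡ true
  anyOf-true σ g (y ∷ xs) (here refl) gx rewrite gx = refl
  anyOf-true σ g (y ∷ xs) (there x∈xs) gx rewrite anyOf-true σ g xs x∈xs gx = ∨-zeroʳ _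

  anyOf-false : ∀ σ (g : I → Guard) xs → (∀ x → holds σ (g x) ≡ false) → holds σ (anyOf xs g) ≡ false
  anyOf-false σ g [] _ = refl
  anyOf-false σ g (y ∷ xs) ¬g rewrite ¬g y = anyOf-false σ g xs ¬g

  cases : List I → (I → Guard) → (I → Program) → Program
  cases [] g b = skip
  cases (x ∷ xs) g b = ifP (g x) (b x) (cases xs g b)

  cases-select : DecidableEquality I → ∀ {σ τ} (g : I → Guard) (b : I → Program) {x} xs → x ∈ xs →
                 holds σ (g x) ≡ true → (∀ y → y ≢ x → holds σ (g y) ≡ false) →
                 Yield (b x) σ τ → Yield (cases xs g b) σ τ
  cases-select _≟_ g b {x} (y ∷ xs) x∈ gx ¬gy yb with y ≟ x
  ... | yes refl = yIfT gx yb
  ... | no y≢x with x∈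
  ...   | here refl = ⊥-elim (y≢x refl)
  ...   | there x∈xs = yIfF (¬gy y y≢x) (cases-select _≟_ g b xs x∈xs gx ¬gy yb)

  whileSome : List I → (I → Guard) → (I → Program) → Program
  whileSome xs g b = doP (anyOf xs g) (cases xs g b)

  whileSome-step : DecidableEquality I → ∀ {σ ρ τ} (g : I → Guard) (b : I → Program) {x} xs → x ∈ xs →
                   holds σ (g x) ≡ true → (∀ y → y ≢ x → holds σ (g y) ≡ false) →
                   Yield (b x) σ ρ → Yield (whileSome xs g b) ρ τ → Yield (whileSome xs g b) σ τ
  whileSome-step _≟_ {σ} g b xs x∈ gx ¬gy yb yl =
    yDoT (anyOf-true σ g xs x∈ gx) (cases-select _≟_ g b xs x∈ gx ¬gy yb) yl

  whileSome-stop : ∀ {σ} (g : I → Guard) (b : I → Program) xs → (∀ x → holds σ (g x) ≡ false) →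
                   Yield (whileSome xs g b) σ σ
  whileSome-stop {σ} g b xs ¬g = yDoF (anyOf-false σ g xs ¬g)

-- Strings

symPtr : ∀ {s} → Fin s → ℕ
symPtr γ = suc (toℕ γ)

symPtr≤s : ∀ {s} (γ : Fin s) → symPtr γ ≤ s
symPtr≤s γ = FP.toℕ<n γ

symPtr-injective : ∀ {s} {γ γ' : Fin s} → symPtr γ ≡ symPtr γ' → γ ≡ γ'
symPtr-injective e = FP.toℕ-injective (NP.suc-injective e)

-- The symbol pointers of σ are those of the string u laid out on the atoms c i, c (1 + i), ….
Spells : ∀ {s} → (ℕ → Atom) → Structure → ℕ → List (Fin s) → Set
Spells c σ i u = ∀ γ a → deref σ (symPtr γ) a ≡ ptr c i u γ a

length-snoc : ∀ {A : Set} (v : List A) x → length (v ++ x ∷ []) ≡ suc (length v)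
length-snoc v x = trans (LP.length-++ v) (NP.+-comm (length v) 1)

module Strings {s : ℕ} (c : ℕ → Atom) where

  ptr-match : ∀ i x u (γ : Fin s) a → c i ≡ a → x ≡ γ → ptr c i (x ∷ u) γ a ≡ just (c (suc i))
  ptr-match i x u γ a ci≡a x≡γ rewrite dec-true (c i N.≟ a) ci≡a | dec-true (x F.≟ γ) x≡γ = refl

  ptr-skip : ∀ i x u (γ : Fin s) a → (c i ≢ a) ⊎ (x ≢ γ) → ptr c i (x ∷ u) γ a ≡ ptr c (suc i) u γ a
  ptr-skip i x u γ a (inj₁ ci≢a) rewrite dec-false (c i N.≟ a) ci≢a = refl
  ptr-skip i x u γ a (inj₂ x≢γ) rewrite dec-false (x F.≟ γ) x≢γ | ∧-zeroʳ (does (c i N.≟ a)) = refl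

  ptr-below : Injective _≡_ _≡_ c → ∀ i j u (γ : Fin s) → j < i → ptr c i u γ (c j) ≡ nothing
  ptr-below inj i j [] γ j<i = refl
  ptr-below inj i j (x ∷ u) γ j<i =
    trans (ptr-skip i x u γ (c j) (inj₁ λ e → NP.<-irrefl (sym (inj e)) j<i))
          (ptr-below inj (suc i) j u γ (NP.m<n⇒m<1+n j<i))

  ptr-above : Injective _≡_ _≡_ c → ∀ i u (γ : Fin s) j → i + length u ≤ j → ptr c i u γ (c j) ≡ nothing
  ptr-above inj i [] γ j _ = refl
  ptr-above inj i (x ∷ u) γ j i+∣xu∣≤j =
    trans (ptr-skip i x u γ (c j) (inj₁ λ e → NP.<-irrefl (inj e)
                                             (NP.<-≤-trans (NP.m≤m+n (suc i) (length u)) le)))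
          (ptr-above inj (suc i) u γ j le)
    where
    le : suc i + length u ≤ j
    le = subst (_≤ j) (NP.+-suc i (length u)) i+∣xu∣≤j

  ptr-∷ : ∀ i x u (γ : Fin s) a →
          (c i ≡ a × x ≡ γ) ⊎ (((c i ≢ a) ⊎ (x ≢ γ)) × ptr c i (x ∷ u) γ a ≡ ptr c (suc i) u γ a)
  ptr-∷ i x u γ a = view (c i N.≟ a) (x F.≟ γ)
    where
    view : Dec (c i ≡ a) → Dec (x ≡ γ) →
           (c i ≡ a × x ≡ γ) ⊎ (((c i ≢ a) ⊎ (x ≢ γ)) × ptr c i (x ∷ u) γ a ≡ ptr c (suc i) u γ a)
    view (yes ci≡a) (yes x≡γ) = inj₁ (ci≡a , x≡γ)
    view (yes _) (no x≢γ) = inj₂ (inj₂ x≢γ , ptr-skip i x u γ a (inj₂ x≢γ))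
    view (no ci≢a) _ = inj₂ (inj₁ ci≢a , ptr-skip i x u γ a (inj₁ ci≢a))

  ptr-just : ∀ i u (γ : Fin s) a b → ptr c i u γ a ≡ just b →
             Σ ℕ λ j → i ≤ j × j < i + length u × a ≡ c j × b ≡ c (suc j)
  ptr-just i [] γ a b ()
  ptr-just i (x ∷ u) γ a b e with ptr-∷ i x u γ a
  ... | inj₁ (refl , refl) with refl ← trans (sym (ptr-match i x u x (c i) refl refl)) e =
    i , NP.≤-refl , NP.m<m+n i (s≤s z≤n) , refl , refl
  ... | inj₂ (_ , skip) with ptr-just (suc i) u γ a b (trans (sym skip) e)
  ...   | j , i<j , j<1+i+∣u∣ , a≡cj , b≡c1+j =
    j , NP.<⇒≤ i<j , subst (j <_) (sym (NP.+-suc i (length u))) j<1+i+∣u∣ , a≡cj , b≡c1+j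

  ptr-snoc-hit : Injective _≡_ _≡_ c → ∀ i u (γ : Fin s) →
                 ptr c i (u ++ γ ∷ []) γ (c (i + length u)) ≡ just (c (suc (i + length u)))
  ptr-snoc-hit inj i [] γ rewrite NP.+-identityʳ i = ptr-match i γ [] γ (c i) refl refl
  ptr-snoc-hit inj i (x ∷ u) γ rewrite NP.+-suc i (length u) =
    trans (ptr-skip i x (u ++ γ ∷ []) γ (c (suc (i + length u))) (inj₁ λ e → NP.m≢1+m+n i (inj e)))
          (ptr-snoc-hit inj (suc i) u γ)

  ptr-snoc-miss : ∀ i u (γ γ' : Fin s) a → (c (i + length u) ≢ a) ⊎ (γ ≢ γ') →
                  ptr c i (u ++ γ ∷ []) γ' a ≡ ptr c i u γ' a
  ptr-snoc-miss i [] γ γ' a miss rewrite NP.+-identityʳ i = ptr-skip i γ [] γ' a miss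
  ptr-snoc-miss i (x ∷ u) γ γ' a miss rewrite NP.+-suc i (length u) with ptr-∷ i x u γ' a
  ... | inj₁ (ci≡a , x≡γ') =
    trans (ptr-match i x (u ++ γ ∷ []) γ' a ci≡a x≡γ') (sym (ptr-match i x u γ' a ci≡a x≡γ'))
  ... | inj₂ (m , skip) =
    trans (ptr-skip i x (u ++ γ ∷ []) γ' a m) (trans (ptr-snoc-miss (suc i) u γ γ' a miss) (sym skip))

maxUpTo : (ℕ → ℕ) → ℕ → ℕ
maxUpTo f zero = f zero
maxUpTo f (suc n) = f (suc n) ⊔ maxUpTo f n

≤-maxUpTo : ∀ f {j n} → j ≤ n → f j ≤ maxUpTo f n
≤-maxUpTo f {zero} {zero} _ = NP.≤-refl
≤-maxUpTo f {j} {suc n} j≤1+n with NP.m≤n⇒m<n∨m≡n j≤1+n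
... | inj₁ j<1+n = NP.≤-trans (≤-maxUpTo f (NP.≤-pred j<1+n)) (NP.m≤n⊔m (f (suc n)) (maxUpTo f n))
... | inj₂ refl = NP.m≤m⊔n (f (suc n)) (maxUpTo f n)

module 𝒯-Properties {s : ℕ} (c : ℕ → Atom) (w : List (Fin s)) where
  open Strings {s} c

  𝒯-spells : Spells c (𝒯 c w) 0 w
  𝒯-spells γ a with toℕ γ <? s
  ... | yes γ<s = cong (λ γ' → ptr c 0 w γ' a) (FP.fromℕ<-toℕ γ γ<s)
  ... | no γ≮s = ⊥-elim (γ≮s (FP.toℕ<n γ))

  𝒯-bound : ℕ
  𝒯-bound = suc (maxUpTo c (length w))

  𝒯-bounded : Bounded (𝒯 c w) 𝒯-bound
  𝒯-bounded = mkBounded entry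
    where
    below : ∀ {j} → j ≤ length w → c j < 𝒯-bound
    below j≤∣w∣ = s≤s (≤-maxUpTo c j≤∣w∣)
    entry : ∀ f as b → strVal c w f as ≡ just b → (b < 𝒯-bound) × (∀ a → a VM.∈ as → a < 𝒯-bound)
    entry (zero , zero) [] b refl = below z≤n , λ _ ()
    entry (suc j , suc zero) (a ∷ []) b e with j <? s
    ... | yes j<s with ptr-just 0 w (fromℕ< j<s) a b e
    ...   | i , _ , i<∣w∣ , refl , refl = below i<∣w∣ , λ { _ (VAny.here refl) → below (NP.<⇒≤ i<∣w∣) }

module Stacks (s k : ℕ) where

  Sym : Set
  Sym = TapeSym s k

  _≟S_ : DecidableEquality Sym
  _≟S_ = MP.≡-dec (SP.≡-dec F._≟_ F._≟_)

  allSyms : List Sym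
  allSyms = nothing ∷ map (just ∘ inj₁) (allFin s) ++ map (just ∘ inj₂) (allFin k)

  ∈-allSyms : ∀ x → x ∈ allSyms
  ∈-allSyms nothing = here refl
  ∈-allSyms (just (inj₁ i)) = there (∈-++⁺ˡ (∈-map⁺ (just ∘ inj₁) (∈-allFin i)))
  ∈-allSyms (just (inj₂ j)) = there (∈-++⁺ʳ (map (just ∘ inj₁) (allFin s)) (∈-map⁺ (just ∘ inj₂) (∈-allFin j)))

  -- Pointer names: 1 … s are the symbols of Σ (as in 𝒯), next links the cells of a stack,
  -- and cell x marks a cell holding the tape symbol x.
  next : ℕ
  next = suc s

  code : Sym → ℕ
  code nothing = 0
  code (just y) = suc (toℕ (F.join s k y))

  cell : Sym → ℕ
  cell x = suc (next + code x)

  cell-injective : ∀ {x y} → cell x ≡ cell y → x ≡ y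
  cell-injective {x} {y} e = code-injective x y (NP.+-cancelˡ-≡ next _ _ (NP.suc-injective e))
    where
    code-injective : ∀ x y → code x ≡ code y → x ≡ y
    code-injective nothing nothing _ = refl
    code-injective (just x) (just y) e = cong just (begin
      x                             ≡⟨ FP.splitAt-join s k x ⟨
      F.splitAt s (F.join s k x)    ≡⟨ cong (F.splitAt s) (FP.toℕ-injective (NP.suc-injective e)) ⟩
      F.splitAt s (F.join s k y)    ≡⟨ FP.splitAt-join s k y ⟩
      y                             ∎)
      where open ≡-Reasoning

  cell≢next : ∀ x → cell x ≢ next
  cell≢next x e = NP.m≢1+m+n s (sym (NP.suc-injective e))

  s<next : s < next
  s<next = NP.n<1+n s

  s<cell : ∀ x → s < cell x
  s<cell x = NP.<-trans s<next (s≤s (NP.m≤m+n next (code x)))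

  symbol≢link : ∀ {p q} → p ≤ s → s < q → p ≢ q
  symbol≢link p≤s s<q refl = NP.<⇒≱ s<q p≤s

  Carries : Structure → Atom → Sym → Set
  Carries σ a x = (deref σ (cell x) a ≡ just a) × (∀ y → y ≢ x → deref σ (cell y) a ≡ nothing)

  Stack : Structure → Maybe Atom → List Sym → Set
  Stack σ nothing [] = ⊤
  Stack σ (just a) (x ∷ xs) = Carries σ a x × Stack σ (deref σ next a) xs
  Stack σ _ _ = ⊥

  Stack-[]⁻ : ∀ {σ} m → Stack σ m [] → m ≡ nothing
  Stack-[]⁻ nothing _ = refl

  Stack-∷⁻ : ∀ {σ} m {x xs} → Stack σ m (x ∷ xs) →
             Σ Atom λ a → (m ≡ just a) × Carries σ a x × Stack σ (deref σ next a) xs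
  Stack-∷⁻ (just a) (cx , st) = a , refl , cx , st

  Stack-∷ : ∀ {σ m a x xs} → m ≡ just a → Carries σ a x → Stack σ (deref σ next a) xs → Stack σ m (x ∷ xs)
  Stack-∷ refl cx st = cx , st

  Stack-top : ∀ {σ m m' xs} → m' ≡ m → Stack σ m xs → Stack σ m' xs
  Stack-top refl st = st

  Carries⇒defined : ∀ {σ} n {a x} → tok σ n ≡ just a → Carries σ a x →
                    holds σ (isDefined (cell x ＠ n)) ≡ true
  Carries⇒defined {σ} n {x = x} tn cx =
    isDefined-just σ (cell x ＠ n) (trans (eval-＠ σ (cell x) n tn) (proj₁ cx))

  Carries⇒undefined : ∀ {σ} n {a x} → tok σ n ≡ just a → Carries σ a x →
                      ∀ y → y ≢ x → holds σ (isDefined (cell y ＠ n)) ≡ false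
  Carries⇒undefined {σ} n tn cx y y≢x =
    isDefined-nothing σ (cell y ＠ n) (trans (eval-＠ σ (cell y) n tn) (proj₂ cx y y≢x))

  -- Stacks live in pointers above s at atoms below the current bound.
  LinksAgree : Structure → Structure → ℕ → Set
  LinksAgree σ σ' B = ∀ p a → s < p → a < B → deref σ' p a ≡ deref σ p a

  Carries-below : ∀ {σ B a x} → Bounded σ B → Carries σ a x → a < B
  Carries-below bd (cx , _) = deref-arg-bounded bd cx

  Carries-links : ∀ {σ σ' B a x} → Bounded σ B → LinksAgree σ σ' B → Carries σ a x → Carries σ' a x
  Carries-links {a = a} {x} bd agree cx =
    trans (agree (cell x) a (s<cell x) (Carries-below bd cx)) (proj₁ cx) ,
    λ y y≢x → trans (agree (cell y) a (s<cell y) (Carries-below bd cx)) (proj₂ cx y y≢x)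

  Stack-links : ∀ {σ σ' B} m xs → Bounded σ B → LinksAgree σ σ' B → Stack σ m xs → Stack σ' m xs
  Stack-links nothing [] bd agree st = tt
  Stack-links {σ' = σ'} (just a) (x ∷ xs) bd agree (cx , st)
    rewrite sym (agree next a s<next (Carries-below bd cx)) =
    Carries-links {σ' = σ'} bd agree cx , Stack-links _ xs bd agree st

  record Frame (σ σ' : Structure) (B : ℕ) (keep : ℕ → Set) : Set where
    constructor mkFrame
    field
      tokens  : ∀ n → keep n → tok σ' n ≡ tok σ n
      links   : LinksAgree σ σ' B
      symbols : ∀ p a → p ≤ s → deref σ' p a ≡ deref σ p a
  open Frame public

  Frame-trans : ∀ {σ σ₁ σ₂ B B' keep₁ keep₂} → B ≤ B' → Frame σ σ₁ B keep₁ → Frame σ₁ σ₂ B' keep₂ →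
                Frame σ σ₂ B (λ n → keep₁ n × keep₂ n)
  Frame-trans B≤B' f₁ f₂ = mkFrame
    (λ n (k₁ , k₂) → trans (tokens f₂ n k₂) (tokens f₁ n k₁))
    (λ p a s<p a<B → trans (links f₂ p a s<p (NP.<-≤-trans a<B B≤B')) (links f₁ p a s<p a<B))
    (λ p a p≤s → trans (symbols f₂ p a p≤s) (symbols f₁ p a p≤s))

  Frame-weaken : ∀ {σ σ' B keep keep'} → (∀ n → keep' n → keep n) → Frame σ σ' B keep → Frame σ σ' B keep'
  Frame-weaken k'⇒k f = mkFrame (λ n k' → tokens f n (k'⇒k n k')) (links f) (symbols f)

  Frame-tok : ∀ {σ σ' m r B} → σ' ≈ σ [ (m , 0) , [] ↦ r ] → Frame σ σ' B (_≢ m)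
  Frame-tok e = mkFrame (tok-miss e) (λ p a _ _ → tok-keeps-deref e p a) (λ p a _ → tok-keeps-deref e p a)

  Stack-frame : ∀ {σ σ' B keep} n {xs} → Bounded σ B → Frame σ σ' B keep → keep n →
                Stack σ (tok σ n) xs → Stack σ' (tok σ' n) xs
  Stack-frame n {xs} bd f keep-n st = Stack-top (tokens f n keep-n) (Stack-links _ xs bd (links f) st)

  Frame-refl : ∀ {σ B keep} → Frame σ σ B keep
  Frame-refl = mkFrame (λ _ _ → refl) (λ _ _ _ _ → refl) (λ _ _ _ → refl)

  -- Token 3 is scratch space for the revisions below.
  push : ℕ → Sym → Program
  push S x = fresh 3 ⨾ (extendAt (cell x) 3 (var 3) ⨾ (extendAt next 3 (var S) ⨾ assign S (var 3)))

  pop : ℕ → Program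
  pop S = assign 3 (next ＠ S) ⨾ assign S (var 3)

  push-revises : ∀ {σ B} S x {xs} → S ≢ 3 → Bounded σ B → Stack σ (tok σ S) xs →
                 Σ Structure λ σ' → Yield (push S x) σ σ' × Bounded σ' (suc B) ×
                   Stack σ' (tok σ' S) (x ∷ xs) × Frame σ σ' B (λ n → n ≢ 3 × n ≢ S)
  push-revises {σ} {B} S x {xs} S≢3 bd st =
    let (σ₁ , y₁ , e₁ , bd₁) = fresh-revises bd 3
        t₁ : tok σ₁ 3 ≡ just B
        t₁ = tok-hit e₁
        unused₁ : ∀ p → deref σ₁ p B ≡ nothing
        unused₁ p = trans (tok-keeps-deref e₁ p B) (deref-bound bd)
        (σ₂ , y₂ , e₂ , bd₂) = extendAt-revises bd₁ (cell x) 3 3 t₁ (unused₁ (cell x))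
        (σ₃ , y₃ , e₃ , bd₃) = extendAt-revises bd₂ next 3 S (trans (deref-keeps-tok e₂ 3) t₁)
                                 (trans (deref-missᶦ e₂ next B λ e → cell≢next x (sym e)) (unused₁ next))
        (σ₄ , y₄ , e₄ , bd₄) = assign-revises bd₃ S 3 λ e → S≢3 (sym e)
        ptr₄₂ : ∀ p a → p ≢ next → deref σ₄ p a ≡ deref σ₂ p a
        ptr₄₂ p a p≢next = trans (tok-keeps-deref e₄ p a) (deref-missᶦ e₃ p a p≢next)
        top : tok σ₄ S ≡ just B
        top = trans (tok-hit e₄) (trans (deref-keeps-tok e₃ 3) (trans (deref-keeps-tok e₂ 3) t₁))
        carries : Carries σ₄ B x
        carries = trans (ptr₄₂ (cell x) B (cell≢next x)) (trans (deref-hit e₂) t₁) ,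
                  λ y y≢x → trans (ptr₄₂ (cell y) B (cell≢next y))
                              (trans (deref-missᶦ e₂ (cell y) B λ e → y≢x (cell-injective e)) (unused₁ (cell y)))
        below-top : deref σ₄ next B ≡ tok σ S
        below-top = trans (tok-keeps-deref e₄ next B)
                      (trans (deref-hit e₃) (trans (deref-keeps-tok e₂ S) (tok-miss e₁ S S≢3)))
        links′ : LinksAgree σ σ₄ B
        links′ p a _ a<B = let a≢B = λ a≡B → NP.<-irrefl a≡B a<B in
          trans (tok-keeps-deref e₄ p a) (trans (deref-missᵃ e₃ p a a≢B)
            (trans (deref-missᵃ e₂ p a a≢B) (tok-keeps-deref e₁ p a)))
        frame : Frame σ σ₄ B (λ n → n ≢ 3 × n ≢ S)
        frame = mkFrame
          (λ n (n≢3 , n≢S) → trans (tok-miss e₄ n n≢S) (trans (deref-keeps-tok e₃ n)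
                               (trans (deref-keeps-tok e₂ n) (tok-miss e₁ n n≢3))))
          links′
          (λ p a p≤s → trans (ptr₄₂ p a (symbol≢link p≤s s<next))
                         (trans (deref-missᶦ e₂ p a (symbol≢link p≤s (s<cell x))) (tok-keeps-deref e₁ p a)))
    in σ₄ , ySeq y₁ (ySeq y₂ (ySeq y₃ y₄)) , bd₄ ,
       Stack-∷ top carries (Stack-top below-top (Stack-links _ xs bd links′ st)) , frame

  pop-revises : ∀ {σ B} S {x xs} → S ≢ 3 → Bounded σ B → Stack σ (tok σ S) (x ∷ xs) →
                Σ Structure λ σ' → Yield (pop S) σ σ' × Bounded σ' B ×
                  Stack σ' (tok σ' S) xs × Frame σ σ' B (λ n → n ≢ 3 × n ≢ S)
  pop-revises {σ} {B} S {xs = xs} S≢3 bd stack =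
    let (a , ta , _ , st) = Stack-∷⁻ _ stack
        (σ₁ , y₁ , e₁ , bd₁) = assign-＠-revises bd 3 next S S≢3 ta
        (σ₂ , y₂ , e₂ , bd₂) = assign-revises bd₁ S 3 λ e → S≢3 (sym e)
        ptrs : ∀ p b → deref σ₂ p b ≡ deref σ p b
        ptrs p b = trans (tok-keeps-deref e₂ p b) (tok-keeps-deref e₁ p b)
        top : tok σ₂ S ≡ deref σ next a
        top = trans (tok-hit e₂) (tok-hit e₁)
    in σ₂ , ySeq y₁ y₂ , bd₂ , Stack-top top (Stack-links _ xs bd (λ p b _ _ → ptrs p b) st) ,
       mkFrame (λ n (n≢3 , n≢S) → trans (tok-miss e₂ n n≢S) (tok-miss e₁ n n≢3))
               (λ p b _ _ → ptrs p b) (λ p b _ → ptrs p b)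

  -- The top symbol must be known to the program, hence the case distinction over all symbols.
  moveTop : ℕ → ℕ → Program
  moveTop S T = cases allSyms (λ z → isDefined (cell z ＠ S)) (λ z → push T z ⨾ pop S)

  moveTop-revises : ∀ {σ B} S T {z zs ys} → S ≢ 3 → T ≢ 3 → S ≢ T → Bounded σ B →
                    Stack σ (tok σ S) (z ∷ zs) → Stack σ (tok σ T) ys →
                    Σ Structure λ σ' → Yield (moveTop S T) σ σ' × Bounded σ' (suc B) ×
                      Stack σ' (tok σ' S) zs × Stack σ' (tok σ' T) (z ∷ ys) ×
                      Frame σ σ' B (λ n → n ≢ 3 × n ≢ S × n ≢ T)
  moveTop-revises {σ} {B} S T {z} {zs} {ys} S≢3 T≢3 S≢T bd stS stT =
    let (a , ta , cz , _) = Stack-∷⁻ _ stS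
        (σ₁ , y₁ , bd₁ , stT₁ , f₁) = push-revises T z T≢3 bd stT
        (σ₂ , y₂ , bd₂ , stS₂ , f₂) = pop-revises S S≢3 bd₁ (Stack-frame S bd f₁ (S≢3 , S≢T) stS)
        stT₂ = Stack-frame T bd₁ f₂ (T≢3 , λ e → S≢T (sym e)) stT₁
    in σ₂ ,
       cases-select _≟S_ _ _ allSyms (∈-allSyms z) (Carries⇒defined {σ} S ta cz) (Carries⇒undefined {σ} S ta cz)
         (ySeq y₁ y₂) ,
       bd₂ , stS₂ , stT₂ ,
       Frame-weaken (λ n (n≢3 , n≢S , n≢T) → (n≢3 , n≢T) , (n≢3 , n≢S)) (Frame-trans (NP.n≤1+n B) f₁ f₂)

module Tapes (s k : ℕ) where
  open Stacks s k

  -- A tape is kept as two stacks: the cells left of the head (topmost nearest) under token 1,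
  -- and the head cell followed by the cells to its right under token 2.
  record Tape (σ : Structure) (B : ℕ) (l r : List Sym) : Set where
    constructor mkTape
    field
      bounded : Bounded σ B
      left    : Stack σ (tok σ 1) l
      right   : Stack σ (tok σ 2) r
  open Tape public

  Tape-links : ∀ {σ σ' B B' l r} → Tape σ B l r → Bounded σ' B' → LinksAgree σ σ' B →
               tok σ' 1 ≡ tok σ 1 → tok σ' 2 ≡ tok σ 2 → Tape σ' B' l r
  Tape-links {l = l} {r} t bd' agree same₁ same₂ =
    mkTape bd' (Stack-top same₁ (Stack-links _ l (bounded t) agree (left t)))
               (Stack-top same₂ (Stack-links _ r (bounded t) agree (right t)))

  Tape-frame : ∀ {σ σ' B B' keep l r} → Tape σ B l r → Bounded σ' B' → Frame σ σ' B keep →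
               keep 1 → keep 2 → Tape σ' B' l r
  Tape-frame t bd' f keep₁ keep₂ = Tape-links t bd' (links f) (tokens f 1 keep₁) (tokens f 2 keep₂)

  OffTape : ℕ → Set
  OffTape n = n ≢ 1 × n ≢ 2 × n ≢ 3

  OffTape-0 : OffTape 0
  OffTape-0 = (λ ()) , (λ ()) , (λ ())

  OffTape-high : ∀ j → OffTape (6 + j)
  OffTape-high j = (λ ()) , (λ ()) , (λ ())

  TapeStep : Program → Structure → ℕ → List Sym → List Sym → ℕ → Set
  TapeStep P σ B l r B' = Σ Structure λ σ' → Yield P σ σ' × Tape σ' B' l r × Frame σ σ' B OffTape

  pushLeft : ∀ {σ B l r} x → Tape σ B l r → TapeStep (push 1 x) σ B (x ∷ l) r (suc B)
  pushLeft x t =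
    let (σ' , y , bd' , st , f) = push-revises 1 x (λ ()) (bounded t) (left t)
    in σ' , y , mkTape bd' st (Stack-frame 2 (bounded t) f ((λ ()) , (λ ())) (right t)) ,
       Frame-weaken (λ _ (n≢1 , _ , n≢3) → n≢3 , n≢1) f

  pushRight : ∀ {σ B l r} x → Tape σ B l r → TapeStep (push 2 x) σ B l (x ∷ r) (suc B)
  pushRight x t =
    let (σ' , y , bd' , st , f) = push-revises 2 x (λ ()) (bounded t) (right t)
    in σ' , y , mkTape bd' (Stack-frame 1 (bounded t) f ((λ ()) , (λ ())) (left t)) st ,
       Frame-weaken (λ _ (_ , n≢2 , n≢3) → n≢3 , n≢2) f

  popRight : ∀ {σ B l x r} → Tape σ B l (x ∷ r) → TapeStep (pop 2) σ B l r B
  popRight t =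
    let (σ' , y , bd' , st , f) = pop-revises 2 (λ ()) (bounded t) (right t)
    in σ' , y , mkTape bd' (Stack-frame 1 (bounded t) f ((λ ()) , (λ ())) (left t)) st ,
       Frame-weaken (λ _ (_ , n≢2 , n≢3) → n≢3 , n≢2) f

  moveRight : ∀ {σ B z l r} → Tape σ B (z ∷ l) r → TapeStep (moveTop 1 2) σ B l (z ∷ r) (suc B)
  moveRight t =
    let (σ' , y , bd' , stL , stR , f) = moveTop-revises 1 2 (λ ()) (λ ()) (λ ()) (bounded t) (left t) (right t)
    in σ' , y , mkTape bd' stL stR , Frame-weaken (λ _ (n≢1 , n≢2 , n≢3) → n≢3 , n≢1 , n≢2) f

  -- Cells beyond the stored part of the tape are blank.
  nearest : List Sym → Sym
  nearest [] = nothing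
  nearest (x ∷ _) = x

  beyond : List Sym → List Sym
  beyond [] = []
  beyond (_ ∷ xs) = xs

  ensureHead : Program
  ensureHead = ifP (isDefined (var 2)) skip (push 2 nothing)

  ensureHead-revises : ∀ {σ B l} r → Tape σ B l r →
                       Σ ℕ λ B' → TapeStep ensureHead σ B l (nearest r ∷ beyond r) B'
  ensureHead-revises {σ} [] t =
    let (σ' , y , t' , f) = pushRight nothing t
    in _ , σ' , yIfF (isDefined-nothing σ (var 2) (Stack-[]⁻ _ (right t))) y , t' , f
  ensureHead-revises {σ} (x ∷ xs) t =
    let (a , ta , _) = Stack-∷⁻ _ (right t)
    in _ , σ , yIfT (isDefined-just σ (var 2) ta) skip-yields , t , Frame-refl

  pullHead : Program
  pullHead = ifP (isDefined (var 1)) (moveTop 1 2) (push 2 nothing)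

  pullHead-revises : ∀ {σ B r} l → Tape σ B l r →
                     Σ ℕ λ B' → TapeStep pullHead σ B (beyond l) (nearest l ∷ r) B'
  pullHead-revises {σ} [] t =
    let (σ' , y , t' , f) = pushRight nothing t
    in _ , σ' , yIfF (isDefined-nothing σ (var 1) (Stack-[]⁻ _ (left t))) y , t' , f
  pullHead-revises {σ} (x ∷ xs) t =
    let (a , ta , _) = Stack-∷⁻ _ (left t)
        (σ' , y , t' , f) = moveRight t
    in _ , σ' , yIfT (isDefined-just σ (var 1) ta) y , t' , f

module Loading (s k : ℕ) where
  open Stacks s k
  open Tapes s k

  inputSym : Fin s → Sym
  inputSym γ = just (inj₁ γ)

  NoSymbols : Structure → Set
  NoSymbols σ = ∀ (γ : Fin s) a → deref σ (symPtr γ) a ≡ nothing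

  -- Token 4 is the reading cursor; the symbol pointer followed is erased so that none survives.
  consume : Fin s → Program
  consume γ = assign 3 (symPtr γ ＠ 4) ⨾ (contractAt (symPtr γ) 4 ⨾ assign 4 (var 3))

  readSymbol : Fin s → Program
  readSymbol γ = push 1 (inputSym γ) ⨾ consume γ

  readSymbols : Program
  readSymbols = whileSome (allFin s) (λ γ → isDefined (symPtr γ ＠ 4)) readSymbol

  readInput : Program
  readInput = assign 4 (var 0) ⨾ readSymbols

  record Prepared (σ : Structure) (B : ℕ) (l r : List Sym) : Set where
    constructor mkPrepared
    field
      tape      : Tape σ B l r
      origin    : Σ Atom λ a → tok σ 0 ≡ just a
      high      : ∀ j → tok σ (6 + j) ≡ nothing
      noSymbols : NoSymbols σ
  open Prepared public

  Prepared-frame : ∀ {σ σ' B B' l r l' r'} → Prepared σ B l r → Tape σ' B' l' r' → Frame σ σ' B OffTape →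
                   Prepared σ' B' l' r'
  Prepared-frame p t f =
    mkPrepared t (proj₁ (origin p) , trans (tokens f 0 OffTape-0) (proj₂ (origin p)))
      (λ j → trans (tokens f (6 + j) (OffTape-high j)) (high p j))
      (λ γ a → trans (symbols f _ a (symPtr≤s γ)) (noSymbols p γ a))

  rewind : Program
  rewind = doP (isDefined (var 1)) (moveTop 1 2)

  rewind-revises : ∀ l {σ B r} → Prepared σ B l r →
                   Σ Structure λ σ' → Σ ℕ λ B' → Yield rewind σ σ' × Prepared σ' B' [] (l ʳ++ r)
  rewind-revises [] {σ} p = σ , _ , yDoF (isDefined-nothing σ (var 1) (Stack-[]⁻ _ (left (tape p)))) , p
  rewind-revises (z ∷ zs) {σ} p =
    let (a , ta , _) = Stack-∷⁻ _ (left (tape p))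
        (σ₁ , y₁ , t₁ , f₁) = moveRight (tape p)
        (σ₂ , B₂ , y₂ , p₂) = rewind-revises zs (Prepared-frame p t₁ f₁)
    in σ₂ , B₂ , yDoT (isDefined-just σ (var 1) ta) y₁ y₂ , p₂

  ensureHead-prepared : ∀ r {σ B} → Prepared σ B [] r →
                        Σ Structure λ σ' → Σ ℕ λ B' →
                          Yield ensureHead σ σ' × Prepared σ' B' [] (nearest r ∷ beyond r)
  ensureHead-prepared r p =
    let (B' , σ' , y , t' , f) = ensureHead-revises r (tape p)
    in σ' , B' , y , Prepared-frame p t' f

  load : Program
  load = readInput ⨾ (rewind ⨾ ensureHead)

  module _ (c : ℕ → Atom) (c-injective : Injective _≡_ _≡_ c) where
    open Strings {s} c
    open 𝒯-Properties {s} c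

    Spells-advance : ∀ {σ σ' i γ u} → Spells c σ i (γ ∷ u) → deref σ' (symPtr γ) (c i) ≡ nothing →
                      (∀ γ' a → (γ' ≢ γ) ⊎ (a ≢ c i) → deref σ' (symPtr γ') a ≡ deref σ (symPtr γ') a) →
                      Spells c σ' (suc i) u
    Spells-advance {i = i} {γ} {u} input erased unchanged γ' a with γ' F.≟ γ | a N.≟ c i
    ... | yes refl | yes refl = trans erased (sym (ptr-below c-injective (suc i) i u γ (NP.n<1+n i)))
    ... | yes refl | no a≢ci =
      trans (unchanged γ a (inj₂ a≢ci)) (trans (input γ a) (ptr-skip i γ u γ a (inj₁ λ e → a≢ci (sym e))))
    ... | no γ'≢γ | _ =
      trans (unchanged γ' a (inj₁ γ'≢γ)) (trans (input γ' a) (ptr-skip i γ u γ' a (inj₂ λ e → γ'≢γ (sym e))))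

    consume-revises : ∀ {σ B i γ u} → Bounded σ B → tok σ 4 ≡ just (c i) → Spells c σ i (γ ∷ u) →
      Σ Structure λ σ' → Yield (consume γ) σ σ' × Bounded σ' B × tok σ' 4 ≡ just (c (suc i)) ×
        Spells c σ' (suc i) u × (∀ n → n ≢ 3 → n ≢ 4 → tok σ' n ≡ tok σ n) × LinksAgree σ σ' B
    consume-revises {σ} {B} {i} {γ} {u} bd cursor input =
      let (σ₁ , y₁ , e₁ , bd₁) = assign-＠-revises bd 3 (symPtr γ) 4 (λ ()) cursor
          (σ₂ , y₂ , e₂ , bd₂) = contractAt-revises bd₁ (symPtr γ) 4 (trans (tok-miss e₁ 4 (λ ())) cursor)
          (σ₃ , y₃ , e₃ , bd₃) = assign-revises bd₂ 4 3 (λ ())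
          next-cell : tok σ₃ 4 ≡ just (c (suc i))
          next-cell = trans (tok-hit e₃) (trans (deref-keeps-tok e₂ 3) (trans (tok-hit e₁)
                        (trans (input γ (c i)) (ptr-match i γ u γ (c i) refl refl))))
          ptrs : ∀ p a → (p ≢ symPtr γ) ⊎ (a ≢ c i) → deref σ₃ p a ≡ deref σ p a
          ptrs p a miss = trans (tok-keeps-deref e₃ p a) (trans (deref-miss e₂ p a miss) (tok-keeps-deref e₁ p a))
      in σ₃ , ySeq y₁ (ySeq y₂ y₃) , bd₃ , next-cell ,
         Spells-advance {σ} {σ₃} {u = u} input (trans (tok-keeps-deref e₃ _ _) (deref-hit e₂))
           (λ { γ' a (inj₁ γ'≢γ) → ptrs _ a (inj₁ λ e → γ'≢γ (symPtr-injective e))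
              ; γ' a (inj₂ a≢ci) → ptrs _ a (inj₂ a≢ci) }) ,
         (λ n n≢3 n≢4 → trans (tok-miss e₃ n n≢4) (trans (deref-keeps-tok e₂ n) (tok-miss e₁ n n≢3))) ,
         (λ p a s<p _ → ptrs p a (inj₁ λ e → symbol≢link (symPtr≤s γ) s<p (sym e)))

    record Reading (σ : Structure) (B i : ℕ) (u : List (Fin s)) (l : List Sym) : Set where
      constructor mkReading
      field
        tape   : Tape σ B l []
        cursor : tok σ 4 ≡ just (c i)
        input  : Spells c σ i u
        origin : Σ Atom λ a → tok σ 0 ≡ just a
        high   : ∀ j → tok σ (6 + j) ≡ nothing
    open Reading

    readSymbol-revises : ∀ {σ B i γ u l} → Reading σ B i (γ ∷ u) l →
      Σ Structure λ σ' → Yield (readSymbol γ) σ σ' × Reading σ' (suc B) (suc i) u (inputSym γ ∷ l)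
    readSymbol-revises {σ} {γ = γ} {u} rd =
      let (σ₁ , y₁ , t₁ , f₁) = pushLeft (inputSym γ) (tape rd)
          (σ₂ , y₂ , bd₂ , cursor₂ , input₂ , toks₂ , links₂) =
            consume-revises {u = u} (bounded t₁) (trans (tokens f₁ 4 ((λ ()) , (λ ()) , (λ ()))) (cursor rd))
              (λ γ' a → trans (symbols f₁ _ a (symPtr≤s γ')) (input rd γ' a))
          kept : ∀ n → OffTape n → n ≢ 4 → tok σ₂ n ≡ tok σ n
          kept n off n≢4 = trans (toks₂ n (proj₂ (proj₂ off)) n≢4) (tokens f₁ n off)
      in σ₂ , ySeq y₁ y₂ ,
         mkReading (Tape-links t₁ bd₂ links₂ (toks₂ 1 (λ ()) (λ ())) (toks₂ 2 (λ ()) (λ ()))) cursor₂ input₂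
           (proj₁ (origin rd) , trans (kept 0 OffTape-0 (λ ())) (proj₂ (origin rd)))
           (λ j → trans (kept (6 + j) (OffTape-high j) (λ ())) (high rd j))

    cursor-reads : ∀ {σ B i u l} → Reading σ B i u l → ∀ γ → eval σ (symPtr γ ＠ 4) ≡ ptr c i u γ (c i)
    cursor-reads {σ} rd γ = trans (eval-＠ σ (symPtr γ) 4 (cursor rd)) (input rd γ _)

    readSymbols-revises : ∀ u {σ B i l} → Reading σ B i u l →
      Σ Structure λ σ' → Σ ℕ λ B' → Σ ℕ λ i' →
        Yield readSymbols σ σ' × Reading σ' B' i' [] (map inputSym u ʳ++ l)
    readSymbols-revises [] {σ} rd =
      σ , _ , _ ,
      whileSome-stop _ _ (allFin s) (λ γ → isDefined-nothing σ (symPtr γ ＠ 4) (cursor-reads rd γ)) , rd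
    readSymbols-revises (γ ∷ u) {σ} {i = i} rd =
      let (σ₁ , y₁ , rd₁) = readSymbol-revises rd
          (σ₂ , B₂ , i₂ , y₂ , rd₂) = readSymbols-revises u rd₁
          next-defined = isDefined-just σ (symPtr γ ＠ 4)
                           (trans (cursor-reads rd γ) (ptr-match i γ u γ (c i) refl refl))
          others-undefined : ∀ γ' → γ' ≢ γ → holds σ (isDefined (symPtr γ' ＠ 4)) ≡ false
          others-undefined γ' γ'≢γ = isDefined-nothing σ (symPtr γ' ＠ 4)
            (trans (cursor-reads rd γ') (trans (ptr-skip i γ u γ' (c i) (inj₂ λ e → γ'≢γ (sym e)))
                                               (ptr-below c-injective (suc i) i u γ' (NP.n<1+n i))))
      in σ₂ , B₂ , i₂ ,
         whileSome-step F._≟_ _ _ (allFin s) (∈-allFin γ) next-defined others-undefined y₁ y₂ , rd₂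

    Reading⇒Prepared : ∀ {σ B i l} → Reading σ B i [] l → Prepared σ B l []
    Reading⇒Prepared rd = mkPrepared (Reading.tape rd) (Reading.origin rd) (Reading.high rd) (Reading.input rd)

    load-revises : ∀ w → Σ Structure λ σ' → Σ ℕ λ B' →
                   Yield load (𝒯 c w) σ' × Prepared σ' B' [] (nearest (map inputSym w) ∷ beyond (map inputSym w))
    load-revises w =
      let (σ₁ , y₁ , e₁ , bd₁) = assign-revises (𝒯-bounded w) 4 0 (λ ())
          kept : ∀ n → n ≢ 4 → tok σ₁ n ≡ tok (𝒯 c w) n
          kept = tok-miss e₁
          reading₁ : Reading σ₁ (𝒯-bound w) 0 w []
          reading₁ = mkReading
                       (mkTape bd₁ (Stack-top {σ₁} (kept 1 (λ ())) tt) (Stack-top {σ₁} (kept 2 (λ ())) tt))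
                       (tok-hit e₁) (λ γ a → trans (tok-keeps-deref e₁ _ a) (𝒯-spells w γ a))
                       (c 0 , kept 0 (λ ())) (λ j → kept (6 + j) (λ ()))
          (σ₂ , _ , _ , y₂ , reading₂) = readSymbols-revises w reading₁
          (σ₃ , _ , y₃ , prepared₃) = rewind-revises (map inputSym w ʳ++ []) (Reading⇒Prepared reading₂)
          rewound : (map inputSym w ʳ++ []) ʳ++ [] ≡ map inputSym w
          rewound = trans (LP.ʳ++-ʳ++ (map inputSym w)) (LP.++-identityʳ (map inputSym w))
          (σ₄ , B₄ , y₄ , prepared₄) =
            ensureHead-prepared (map inputSym w) (subst (Prepared σ₃ _ []) rewound prepared₃)
      in σ₄ , B₄ , ySeq (ySeq y₁ y₂) (ySeq y₃ y₄) , prepared₄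

module Simulation {s : ℕ} (M : TM s) where
  open TM M
  open Stacks s nX
  open Tapes s nX
  open Loading s nX

  -- Token 6 flags that M is running; token 7 + q is defined exactly when M is in state q.
  stateTok : Fin nQ → ℕ
  stateTok q = 6 + suc (toℕ q)

  stateTok-injective : ∀ {q q'} → stateTok q ≡ stateTok q' → q ≡ q'
  stateTok-injective e = FP.toℕ-injective (NP.suc-injective (NP.+-cancelˡ-≡ 6 _ _ e))

  record Control (σ : Structure) (q : Fin nQ) : Set where
    constructor mkControl
    field
      current   : Σ Atom λ a → tok σ (stateTok q) ≡ just a
      others    : ∀ q' → q' ≢ q → tok σ (stateTok q') ≡ nothing
      running   : Σ Atom λ a → tok σ 6 ≡ just a
      origin    : Σ Atom λ a → tok σ 0 ≡ just a
      noSymbols : NoSymbols σ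
  open Control

  Control-frame : ∀ {σ σ' B q} → Frame σ σ' B OffTape → Control σ q → Control σ' q
  Control-frame {q = q} f ctl = mkControl
    (proj₁ (current ctl) , trans (tokens f _ (OffTape-high _)) (proj₂ (current ctl)))
    (λ q' q'≢q → trans (tokens f _ (OffTape-high _)) (others ctl q' q'≢q))
    (proj₁ (running ctl) , trans (tokens f 6 (OffTape-high 0)) (proj₂ (running ctl)))
    (proj₁ (origin ctl) , trans (tokens f 0 OffTape-0) (proj₂ (origin ctl)))
    (λ γ a → trans (symbols f _ a (symPtr≤s γ)) (noSymbols ctl γ a))

  Simulating : Structure → ℕ → Config M → Set
  Simulating σ B C = Tape σ B (Config.left C) (Config.head C ∷ Config.right C) × Control σ (Config.state C)

  switch : Fin nQ → Fin nQ → Program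
  switch q q' = contract (stateTok q) ⨾ extend (stateTok q') (var 0)

  states-cleared : ∀ {σ σ' q} → σ' ≈ σ [ (stateTok q , 0) , [] ↦ nothing ] → Control σ q →
                   ∀ q'' → tok σ' (stateTok q'') ≡ nothing
  states-cleared {q = q} e ctl q'' with q'' F.≟ q
  ... | yes refl = tok-hit e
  ... | no q''≢q = trans (tok-miss e _ λ e → q''≢q (stateTok-injective e)) (others ctl q'' q''≢q)

  switch-revises : ∀ {σ B l r q} q' → Tape σ B l r → Control σ q →
                   Σ Structure λ σ' → Yield (switch q q') σ σ' × Tape σ' B l r × Control σ' q'
  switch-revises {σ} {q = q} q' t ctl =
    let (σ₁ , y₁ , e₁ , bd₁) = contract-revises (bounded t) (stateTok q)
        all-off = states-cleared e₁ ctl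
        (σ₂ , y₂ , e₂ , bd₂) = extend-revises bd₁ (stateTok q') 0 (all-off q')
        kept : ∀ n → n ≢ stateTok q → n ≢ stateTok q' → tok σ₂ n ≡ tok σ n
        kept n n≢q n≢q' = trans (tok-miss e₂ n n≢q') (tok-miss e₁ n n≢q)
        ptrs : ∀ p a → deref σ₂ p a ≡ deref σ p a
        ptrs p a = trans (tok-keeps-deref e₂ p a) (tok-keeps-deref e₁ p a)
    in σ₂ , ySeq y₁ y₂ , Tape-links t bd₂ (λ p a _ _ → ptrs p a) (kept 1 (λ ()) (λ ())) (kept 2 (λ ()) (λ ())) ,
       mkControl (proj₁ (origin ctl) , trans (tok-hit e₂) (trans (tok-miss e₁ 0 (λ ())) (proj₂ (origin ctl))))
         (λ q'' q''≢q' → trans (tok-miss e₂ _ λ e → q''≢q' (stateTok-injective e)) (all-off q''))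
         (proj₁ (running ctl) , trans (kept 6 (λ ()) (λ ())) (proj₂ (running ctl)))
         (proj₁ (origin ctl) , trans (kept 0 (λ ()) (λ ())) (proj₂ (origin ctl)))
         (λ γ a → trans (ptrs _ a) (noSymbols ctl γ a))

  -- Change the state and drop the scanned cell, which the move then replaces by the written one.
  enter : Fin nQ → Fin nQ → Program
  enter q q' = switch q q' ⨾ pop 2

  enter-revises : ∀ {σ B l h r q} q' → Tape σ B l (h ∷ r) → Control σ q →
                  Σ Structure λ σ' → Yield (enter q q') σ σ' × Tape σ' B l r × Control σ' q'
  enter-revises q' t ctl =
    let (σ₁ , y₁ , t₁ , ctl₁) = switch-revises q' t ctl
        (σ₂ , y₂ , t₂ , f₂) = popRight t₁
    in σ₂ , ySeq y₁ y₂ , t₂ , Control-frame f₂ ctl₁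

  action : Fin nQ → Maybe (Fin nQ × Sym × Move) → Program
  action q nothing = contract 6
  action q (just (q' , y , R)) = enter q q' ⨾ (push 1 y ⨾ ensureHead)
  action q (just (q' , y , L)) = enter q q' ⨾ (push 2 y ⨾ pullHead)

  stepTM : Program
  stepTM = cases (allFin nQ) (λ q → isDefined (var (stateTok q)))
             (λ q → cases allSyms (λ x → isDefined (cell x ＠ 2)) (λ x → action q (δ q x)))

  runTM : Program
  runTM = doP (isDefined (var 6)) stepTM

  stepTM-selects : ∀ {σ τ B} q l h r → Simulating σ B (cfg q l h r) → Yield (action q (δ q h)) σ τ →
                   Yield stepTM σ τ
  stepTM-selects {σ} q l h r (t , ctl) y =
    let (a , ta , ch , _) = Stack-∷⁻ _ (right t)
    in cases-select F._≟_ _ _ (allFin nQ) (∈-allFin q)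
         (isDefined-just σ (var (stateTok q)) (proj₂ (current ctl)))
         (λ q' q'≢q → isDefined-nothing σ (var (stateTok q')) (others ctl q' q'≢q))
         (cases-select _≟S_ _ _ allSyms (∈-allSyms h) (Carries⇒defined {σ} 2 ta ch)
            (Carries⇒undefined {σ} 2 ta ch) y)

  moveR-revises : ∀ {σ B l h r q} q' y → Tape σ B l (h ∷ r) → Control σ q →
                  Σ Structure λ σ' → Σ ℕ λ B' → Yield (action q (just (q' , y , R))) σ σ' ×
                    Tape σ' B' (y ∷ l) (nearest r ∷ beyond r) × Control σ' q'
  moveR-revises {r = r} q' y t ctl =
    let (σ₁ , y₁ , t₁ , ctl₁) = enter-revises q' t ctl
        (σ₂ , y₂ , t₂ , f₂) = pushLeft y t₁
        (B₃ , σ₃ , y₃ , t₃ , f₃) = ensureHead-revises r t₂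
    in σ₃ , B₃ , ySeq y₁ (ySeq y₂ y₃) , t₃ , Control-frame f₃ (Control-frame f₂ ctl₁)

  moveL-revises : ∀ {σ B l h r q} q' y → Tape σ B l (h ∷ r) → Control σ q →
                  Σ Structure λ σ' → Σ ℕ λ B' → Yield (action q (just (q' , y , L))) σ σ' ×
                    Tape σ' B' (beyond l) (nearest l ∷ y ∷ r) × Control σ' q'
  moveL-revises {l = l} q' y t ctl =
    let (σ₁ , y₁ , t₁ , ctl₁) = enter-revises q' t ctl
        (σ₂ , y₂ , t₂ , f₂) = pushRight y t₁
        (B₃ , σ₃ , y₃ , t₃ , f₃) = pullHead-revises l t₂
    in σ₃ , B₃ , ySeq y₁ (ySeq y₂ y₃) , t₃ , Control-frame f₃ (Control-frame f₂ ctl₁)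

  via-action : ∀ {σ B q l h r o} {P : Structure → ℕ → Set} → Simulating σ B (cfg q l h r) → δ q h ≡ o →
               Σ Structure (λ σ' → Σ ℕ λ B' → Yield (action q o) σ σ' × P σ' B') →
               Σ Structure λ σ' → Σ ℕ λ B' → Yield stepTM σ σ' × P σ' B'
  via-action {σ} {q = q} {l} {h} {r} sim refl (σ' , B' , y , p) = σ' , B' , stepTM-selects q l h r sim y , p

  step-simulated : ∀ {σ B} C {C'} → Simulating σ B C → step M C ≡ just C' →
                   Σ Structure λ σ' → Σ ℕ λ B' → Yield stepTM σ σ' × Simulating σ' B' C'
  step-simulated (cfg q l h r) (t , ctl) st with δ q h in eq
  ... | just (q' , y , R) with r | st
  ...   | [] | refl = via-action (t , ctl) eq (moveR-revises q' y t ctl)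
  ...   | _ ∷ _ | refl = via-action (t , ctl) eq (moveR-revises q' y t ctl)
  step-simulated (cfg q l h r) (t , ctl) st | just (q' , y , L) with l | st
  ...   | [] | refl = via-action (t , ctl) eq (moveL-revises q' y t ctl)
  ...   | _ ∷ _ | refl = via-action (t , ctl) eq (moveL-revises q' y t ctl)

  halting-δ : ∀ q l h r → step M (cfg q l h r) ≡ nothing → δ q h ≡ nothing
  halting-δ q l h r st with δ q h
  ... | nothing = refl
  ... | just (q' , y , R) with r | st
  ...   | [] | ()
  ...   | _ ∷ _ | ()
  halting-δ q l h r st | just (q' , y , L) with l | st
  ...   | [] | ()
  ...   | _ ∷ _ | ()

  Halted : Structure → ℕ → Config M → Set
  Halted σ B C = Tape σ B (Config.left C) (Config.head C ∷ Config.right C) × NoSymbols σ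

  halt-revises : ∀ {σ B} C → Simulating σ B C → step M C ≡ nothing →
                 Σ Structure λ σ' → Yield stepTM σ σ' × Halted σ' B C × tok σ' 6 ≡ nothing
  halt-revises {σ} (cfg q l h r) (t , ctl) st =
    let (σ' , y , e , bd') = contract-revises (bounded t) 6
        halt : Yield (action q (δ q h)) σ σ'
        halt = subst (λ o → Yield (action q o) σ σ') (sym (halting-δ q l h r st)) y
    in σ' , stepTM-selects q l h r (t , ctl) halt ,
       (Tape-frame t bd' (Frame-tok e) (λ ()) (λ ()) ,
        λ γ a → trans (tok-keeps-deref e _ a) (noSymbols ctl γ a)) ,
       tok-hit e

  run-simulated : ∀ {C D σ B} → Reaches M C D → step M D ≡ nothing → Simulating σ B C →
                  Σ Structure λ σ' → Σ ℕ λ B' → Yield runTM σ σ' × Halted σ' B' D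
  run-simulated {C} {σ = σ} {B} here halts sim =
    let (σ' , y , halted , stopped) = halt-revises C sim halts
    in σ' , B , yDoT (isDefined-just σ (var 6) (proj₂ (running (proj₂ sim)))) y
                  (yDoF (isDefined-nothing σ' (var 6) stopped)) , halted
  run-simulated {C} {σ = σ} (there st reaches) halts sim =
    let (σ₁ , B₁ , y₁ , sim₁) = step-simulated C sim st
        (σ₂ , B₂ , y₂ , halted) = run-simulated reaches halts sim₁
    in σ₂ , B₂ , yDoT (isDefined-just σ (var 6) (proj₂ (running (proj₂ sim)))) y₁ y₂ , halted

  boot : Program
  boot = extend (stateTok start) (var 0) ⨾ extend 6 (var 0)

  boot-revises : ∀ {σ B r} → Prepared σ B [] r →
                 Σ Structure λ σ' → Yield boot σ σ' × Tape σ' B [] r × Control σ' start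
  boot-revises {σ} p =
    let (a , origin₀) = Prepared.origin p
        t = Prepared.tape p
        (σ₁ , y₁ , e₁ , bd₁) = extend-revises (bounded t) (stateTok start) 0 (Prepared.high p _)
        (σ₂ , y₂ , e₂ , bd₂) = extend-revises bd₁ 6 0 (trans (tok-miss e₁ 6 (λ ())) (Prepared.high p 0))
        kept : ∀ n → n ≢ stateTok start → n ≢ 6 → tok σ₂ n ≡ tok σ n
        kept n n≢start n≢6 = trans (tok-miss e₂ n n≢6) (tok-miss e₁ n n≢start)
        ptrs : ∀ p a → deref σ₂ p a ≡ deref σ p a
        ptrs p a = trans (tok-keeps-deref e₂ p a) (tok-keeps-deref e₁ p a)
    in σ₂ , ySeq y₁ y₂ , Tape-links t bd₂ (λ p a _ _ → ptrs p a) (kept 1 (λ ()) (λ ())) (kept 2 (λ ()) (λ ())) ,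
       mkControl (a , trans (tok-miss e₂ _ (λ ())) (trans (tok-hit e₁) origin₀))
         (λ q q≢start → trans (kept _ (λ e → q≢start (stateTok-injective e)) (λ ())) (Prepared.high p _))
         (a , trans (tok-hit e₂) (trans (tok-miss e₁ 0 (λ ())) origin₀))
         (a , trans (kept 0 (λ ()) (λ ())) origin₀)
         (λ γ a → trans (ptrs _ a) (Prepared.noSymbols p γ a))

  Simulating-initial : ∀ {σ B} w → Tape σ B [] (nearest (map inputSym w) ∷ beyond (map inputSym w)) →
                       Control σ start → Simulating σ B (initial M w)
  Simulating-initial [] t ctl = t , ctl
  Simulating-initial (γ ∷ w) t ctl = t , ctl

module Writing {s : ℕ} (M : TM s) where
  open TM M
  open Stacks s nX
  open Loading s nX using (inputSym; NoSymbols)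

  -- Token 5 holds the last atom of the output string written so far; token 4 walks down
  -- the stack of cells, which is left in place.
  beginOutput : Program
  beginOutput = fresh 5 ⨾ (assign 0 (var 5) ⨾ assign 4 (var 2))

  appendSymbol : Fin s → Program
  appendSymbol γ = fresh 3 ⨾ (extendAt (symPtr γ) 5 (var 3) ⨾ assign 5 (var 3))

  writeSymbol : Fin s → Program
  writeSymbol γ = appendSymbol γ ⨾ pop 4

  writeSymbols : Program
  writeSymbols = whileSome (allFin s) (λ γ → isDefined (cell (inputSym γ) ＠ 4)) writeSymbol

  writeOutput : Program
  writeOutput = beginOutput ⨾ writeSymbols

  -- The output string is laid out on the atoms d 0, d 1, …, all above the bound B₀ on the atoms in use.
  module _ (B₀ : ℕ) where

    d : ℕ → Atom
    d j = j + B₀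

    d-injective : Injective _≡_ _≡_ d
    d-injective {i} {j} = NP.+-cancelʳ-≡ B₀ i j

    open Strings {s} d

    Spells-append : ∀ {σ σ' v γ} → Spells d σ 0 v →
                    deref σ' (symPtr γ) (d (length v)) ≡ just (d (suc (length v))) →
                    (∀ γ' a → (γ' ≢ γ) ⊎ (a ≢ d (length v)) → deref σ' (symPtr γ') a ≡ deref σ (symPtr γ') a) →
                    Spells d σ' 0 (v ++ γ ∷ [])
    Spells-append {v = v} {γ} spells appended unchanged γ' a with γ' F.≟ γ | a N.≟ d (length v)
    ... | yes refl | yes refl = trans appended (sym (ptr-snoc-hit d-injective 0 v γ))
    ... | yes refl | no a≢end =
      trans (unchanged γ a (inj₂ a≢end))
            (trans (spells γ a) (sym (ptr-snoc-miss 0 v γ γ a (inj₁ λ e → a≢end (sym e)))))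
    ... | no γ'≢γ | _ =
      trans (unchanged γ' a (inj₁ γ'≢γ))
            (trans (spells γ' a) (sym (ptr-snoc-miss 0 v γ γ' a (inj₂ λ e → γ'≢γ (sym e)))))

    record Written (σ : Structure) (v : List (Fin s)) (xs : List Sym) : Set where
      constructor mkWritten
      field
        bounded   : Bounded σ (suc (d (length v)))
        end       : tok σ 5 ≡ just (d (length v))
        origin    : tok σ 0 ≡ just (d 0)
        spells    : Spells d σ 0 v
        remaining : Stack σ (tok σ 4) xs
    open Written

    beginOutput-revises : ∀ {σ xs} → Bounded σ B₀ → Stack σ (tok σ 2) xs → NoSymbols σ →
                          Σ Structure λ σ' → Yield beginOutput σ σ' × Written σ' [] xs
    beginOutput-revises {σ} {xs} bd st none =
      let (σ₁ , y₁ , e₁ , bd₁) = fresh-revises bd 5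
          (σ₂ , y₂ , e₂ , bd₂) = assign-revises bd₁ 0 5 (λ ())
          (σ₃ , y₃ , e₃ , bd₃) = assign-revises bd₂ 4 2 (λ ())
          ptrs : ∀ p a → deref σ₃ p a ≡ deref σ p a
          ptrs p a = trans (tok-keeps-deref e₃ p a) (trans (tok-keeps-deref e₂ p a) (tok-keeps-deref e₁ p a))
          end₁ : tok σ₁ 5 ≡ just B₀
          end₁ = tok-hit e₁
      in σ₃ , ySeq y₁ (ySeq y₂ y₃) ,
         mkWritten bd₃ (trans (tok-miss e₃ 5 (λ ())) (trans (tok-miss e₂ 5 (λ ())) end₁))
           (trans (tok-miss e₃ 0 (λ ())) (trans (tok-hit e₂) end₁))
           (λ γ a → trans (ptrs _ a) (none γ a))
           (Stack-top (trans (tok-hit e₃) (trans (tok-miss e₂ 2 (λ ())) (tok-miss e₁ 2 (λ ()))))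
              (Stack-links _ xs bd (λ p a _ _ → ptrs p a) st))

    appendSymbol-revises : ∀ {σ v xs} γ → Written σ v xs →
      Σ Structure λ σ' → Yield (appendSymbol γ) σ σ' × Bounded σ' (suc (d (suc (length v)))) ×
        tok σ' 5 ≡ just (d (suc (length v))) × (∀ n → n ≢ 3 → n ≢ 5 → tok σ' n ≡ tok σ n) ×
        Spells d σ' 0 (v ++ γ ∷ []) × LinksAgree σ σ' (suc (d (length v)))
    appendSymbol-revises {σ} {v} γ w =
      let K = length v
          (σ₁ , y₁ , e₁ , bd₁) = fresh-revises (bounded w) 3
          unused : deref σ₁ (symPtr γ) (d K) ≡ nothing
          unused = trans (tok-keeps-deref e₁ _ _)
                         (trans (spells w γ (d K)) (ptr-above d-injective 0 v γ K NP.≤-refl))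
          (σ₂ , y₂ , e₂ , bd₂) = extendAt-revises bd₁ (symPtr γ) 5 3 (trans (tok-miss e₁ 5 (λ ())) (end w)) unused
          (σ₃ , y₃ , e₃ , bd₃) = assign-revises bd₂ 5 3 (λ ())
          ptrs : ∀ p a → (p ≢ symPtr γ) ⊎ (a ≢ d K) → deref σ₃ p a ≡ deref σ p a
          ptrs p a miss = trans (tok-keeps-deref e₃ p a) (trans (deref-miss e₂ p a miss) (tok-keeps-deref e₁ p a))
      in σ₃ , ySeq y₁ (ySeq y₂ y₃) , bd₃ ,
         trans (tok-hit e₃) (trans (deref-keeps-tok e₂ 3) (tok-hit e₁)) ,
         (λ n n≢3 n≢5 → trans (tok-miss e₃ n n≢5) (trans (deref-keeps-tok e₂ n) (tok-miss e₁ n n≢3))) ,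
         Spells-append {σ} {σ₃} {v} (spells w) (trans (tok-keeps-deref e₃ _ _) (trans (deref-hit e₂) (tok-hit e₁)))
           (λ { γ' a (inj₁ γ'≢γ) → ptrs _ a (inj₁ λ e → γ'≢γ (symPtr-injective e))
              ; γ' a (inj₂ a≢end) → ptrs _ a (inj₂ a≢end) }) ,
         (λ p a s<p _ → ptrs p a (inj₁ λ e → symbol≢link (symPtr≤s γ) s<p (sym e)))

    writeSymbol-revises : ∀ {σ v γ xs} → Written σ v (inputSym γ ∷ xs) →
                          Σ Structure λ σ' → Yield (writeSymbol γ) σ σ' × Written σ' (v ++ γ ∷ []) xs
    writeSymbol-revises {σ} {v} {γ} {xs} w =
      let (σ₁ , y₁ , bd₁ , end₁ , toks₁ , spells₁ , links₁) = appendSymbol-revises γ w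
          stack₁ = Stack-top (toks₁ 4 (λ ()) (λ ()))
                     (Stack-links _ (inputSym γ ∷ xs) (bounded w) links₁ (remaining w))
          (σ₂ , y₂ , bd₂ , stack₂ , f₂) = pop-revises 4 (λ ()) bd₁ stack₁
          grown : ∀ {P : ℕ → Set} → P (suc (length v)) → P (length (v ++ γ ∷ []))
          grown {P} = subst P (sym (length-snoc v γ))
      in σ₂ , ySeq y₁ y₂ ,
         mkWritten (grown {λ n → Bounded σ₂ (suc (d n))} bd₂)
           (grown {λ n → tok σ₂ 5 ≡ just (d n)} (trans (tokens f₂ 5 ((λ ()) , (λ ()))) end₁))
           (trans (tokens f₂ 0 ((λ ()) , (λ ()))) (trans (toks₁ 0 (λ ()) (λ ())) (origin w)))
           (λ γ' a → trans (symbols f₂ _ a (symPtr≤s γ')) (spells₁ γ' a))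
           stack₂

    writing-stops : ∀ {σ v x xs} → Written σ v (x ∷ xs) → (∀ γ → inputSym γ ≢ x) →
                    Yield writeSymbols σ σ
    writing-stops {σ} w not-input =
      let (a , ta , cx , _) = Stack-∷⁻ _ (remaining w)
      in whileSome-stop _ _ (allFin s) λ γ → Carries⇒undefined {σ} 4 ta cx (inputSym γ) (not-input γ)

    writeSymbols-revises : ∀ xs {σ v} → Written σ v xs →
      Σ Structure λ σ' → Σ (List (Fin s)) λ v' → Σ (List Sym) λ ys →
        Yield writeSymbols σ σ' × v' ≡ v ++ readOut M xs × Written σ' v' ys
    writeSymbols-revises [] {σ} {v} w =
      σ , v , [] , whileSome-stop _ _ (allFin s) (λ γ → isDefined-nothing σ (cell (inputSym γ) ＠ 4)
                                            (eval-＠-undefined σ (cell (inputSym γ)) 4 (Stack-[]⁻ _ (remaining w)))) ,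
      sym (LP.++-identityʳ v) , w
    writeSymbols-revises (just (inj₁ γ) ∷ xs) {σ} {v} w =
      let (a , ta , cγ , _) = Stack-∷⁻ _ (remaining w)
          (σ₁ , y₁ , w₁) = writeSymbol-revises w
          (σ₂ , v₂ , ys , y₂ , v₂≡ , w₂) = writeSymbols-revises xs w₁
      in σ₂ , v₂ , ys ,
         whileSome-step F._≟_ _ _ (allFin s) (∈-allFin γ) (Carries⇒defined {σ} 4 ta cγ)
           (λ γ' γ'≢γ → Carries⇒undefined {σ} 4 ta cγ (inputSym γ') λ { refl → γ'≢γ refl }) y₁ y₂ ,
         trans v₂≡ (LP.++-assoc v (γ ∷ []) (readOut M xs)) , w₂
    writeSymbols-revises (nothing ∷ xs) {σ} {v} w =
      σ , v , _ , writing-stops w (λ _ ()) , sym (LP.++-identityʳ v) , w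
    writeSymbols-revises (just (inj₂ _) ∷ xs) {σ} {v} w =
      σ , v , _ , writing-stops w (λ _ ()) , sym (LP.++-identityʳ v) , w

    writeOutput-revises : ∀ {σ xs} → Bounded σ B₀ → Stack σ (tok σ 2) xs → NoSymbols σ →
                          Σ Structure λ σ' → Yield writeOutput σ σ' ×
                            tok σ' 0 ≡ just (d 0) × Spells d σ' 0 (readOut M xs)
    writeOutput-revises {xs = xs} bd st none =
      let (σ₁ , y₁ , w₁) = beginOutput-revises bd st none
          (σ₂ , v₂ , ys , y₂ , v₂≡ , w₂) = writeSymbols-revises xs w₁
      in σ₂ , ySeq y₁ y₂ , origin w₂ , subst (Spells d σ₂ 0) v₂≡ (spells w₂)

Step-voc : ∀ {r σ τ} → Step r σ τ → ∀ f → f ∈ voc σ → f ∈ voc τ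
Step-voc (ext {σ} {f} {ts} _ {q}) g g∈σ with evalArgs σ ts
... | nothing = there g∈σ
... | just as with val σ f as
...   | just _ = there g∈σ
...   | nothing = there g∈σ
Step-voc (incDef _) g g∈σ = there g∈σ
Step-voc (incNew _ _ _) g g∈σ = there g∈σ
Step-voc (contr {σ} {f} {ts}) g g∈σ with evalArgs σ ts
... | nothing = there g∈σ
... | just _ = there g∈σ
Step-voc del g g∈σ = there g∈σ

Yield-voc : ∀ {P σ τ} → Yield P σ τ → ∀ f → f ∈ voc σ → f ∈ voc τ
Yield-voc (yRev st) f f∈σ = Step-voc st f f∈σ
Yield-voc (ySeq y₁ y₂) f f∈σ = Yield-voc y₂ f (Yield-voc y₁ f f∈σ)
Yield-voc (yIfT _ y) f f∈σ = Yield-voc y f f∈σ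
Yield-voc (yIfF _ y) f f∈σ = Yield-voc y f f∈σ
Yield-voc (yDoF _) f f∈σ = f∈σ
Yield-voc (yDoT _ y₁ y₂) f f∈σ = Yield-voc y₂ f (Yield-voc y₁ f f∈σ)

Expansion-𝒯 : ∀ {s} (c d : ℕ → Atom) (w v : List (Fin s)) {P τ} → Yield P (𝒯 c w) τ →
              tok τ 0 ≡ just (d 0) → Spells d τ 0 v → Expansion τ (𝒯 d v)
Expansion-𝒯 {s} c d w v {τ = τ} y origin spells = Yield-voc y , agree
  where
  agree : ∀ f → f ∈ voc (𝒯 d v) → ∀ as → val τ f as ≡ val (𝒯 d v) f as
  agree .(0 , 0) (here refl) [] = origin
  agree f (there f∈ptrs) as with ∈-map⁻ (λ (γ : Fin s) → (suc (toℕ γ) , 1)) f∈ptrs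
  ... | γ , _ , refl with as
  ...   | a ∷ [] = trans (spells γ a) (sym (𝒯-Properties.𝒯-spells d v γ a))

module Compilation {s : ℕ} (M : TM s) where
  open TM M
  open Tapes s nX
  open Loading s nX
  open Simulation M
  open Writing M

  compile : Program
  compile = load ⨾ (boot ⨾ (runTM ⨾ writeOutput))

  compile-correct : ∀ w v → Computes M w v → ∀ c → Injective _≡_ _≡_ c →
                    Σ Structure λ τ → Yield compile (𝒯 c w) τ ×
                      Σ (ℕ → Atom) λ d → Injective _≡_ _≡_ d × Expansion τ (𝒯 d v)
  compile-correct w v (cfg q l h r , reaches , halts , refl) c c-injective =
    let (σ₁ , _ , y₁ , prepared) = load-revises c c-injective w
        (σ₂ , y₂ , t₂ , ctl₂) = boot-revises prepared
        (σ₃ , B₃ , y₃ , t₃ , none₃) = run-simulated reaches halts (Simulating-initial w t₂ ctl₂)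
        (τ , y₄ , origin₄ , spells₄) = writeOutput-revises B₃ (bounded t₃) (right t₃) none₃
        y = ySeq y₁ (ySeq y₂ (ySeq y₃ y₄))
    in τ , y , d B₃ , d-injective B₃ , Expansion-𝒯 c (d B₃) w _ y origin₄ spells₄

theorem3 : ∀ {s : ℕ} (M : TM s) → Σ Program λ P →
             ∀ (w v : List (Fin s)) → Computes M w v →
             ∀ (c : ℕ → Atom) → Injective _≡_ _≡_ c →
             Σ Structure λ τ → Yield P (𝒯 c w) τ ×
               Σ (ℕ → Atom) λ d → Injective _≡_ _≡_ d × Expansion τ (𝒯 d v)
theorem3 M = compile , compile-correct
  where open Compilation M
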